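{- If $f$ is a read-once function, then $\Gamma(f)=\mathrm{ds}(f)\cdot\mathrm{cs}(f)$.
   Context: A read-once formula is a Boolean formula over AND and OR gates (each gate having at least two inputs) whose leaves are distinct variables, possibly negated; a read-once function $f:\{0,1\}^n\to\{0,1\}$ is one computed by such a formula. $\mathrm{ds}(f)$ is the minimum number of terms in a DNF formula for $f$, and $\mathrm{cs}(f)$ the minimum number of clauses in a CNF formula for $f$. A partial assignment is $b\in\{0,1,*\}^n$; $a\succeq b$ means $a_i=b_i$ whenever $b_i\ne *$. $b$ is a $0$-certificate (resp. $1$-certificate) of $f$ if $f(a)=0$ (resp. $1$) for all $a\in\{0,1\}^n$ with $a\succeq b$; a certificate is a $0$- or $1$-certificate; $b$ contains a certificate if $b\succeq c$ for some certificate $c$. For $b_i=*$, $b_{x_i\leftarrow\ell}$ is $b$ with coordinate $i$ set to $\ell\in\{0,1\}$. $g:\{0,1,*\}^n\to\mathbb{Z}_{\ge0}$ is monotone if $g(b_{x_i\leftarrow\ell})\ge g(b)$ whenever $b_i=*$, and submodular if $g(b_{x_i\leftarrow\ell})-g(b)\ge g(b'_{x_i\leftarrow\ell})-g(b')$ whenever $b'\succeq b$, $b_i=b'_i=*$. A goal function for $f$ is a monotone submodular $g$ with an integer $Q\ge0$ (its goal value) such that $g(b)=Q$ for all $b\in\{0,1\}^n$ and $g(b)=Q$ iff $b$ contains a certificate of $f$. $\Gamma(f)$ is the minimum goal value of a goal function for $f$. -}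

module Defs where

open import Data.Nat using (ℕ; _≤_; _+_)
open import Data.Bool using (Bool; true; false; _∧_; _∨_; if_then_else_)
open import Data.Fin using (Fin; _≟_)
open import Data.Maybe using (Maybe; just; nothing)
open import Data.List using (List; []; _∷_; _++_; length)
open import Data.List.Relation.Unary.All using (All)
open import Data.List.Relation.Unary.Any using (Any)
open import Data.List.Relation.Unary.Unique.Propositional using (Unique)
open import Data.Sum using (_⊎_)
open import Data.Product using (Σ; _×_; ∃; _,_)
open import Relation.Binary.PropositionalEquality using (_≡_)
open import Relation.Nullary using (yes; no)
open import Function.Bundles using (_⇔_)

Assignment : ℕ → Set
Assignment n = Fin n → Bool

BoolFun : ℕ → Set
BoolFun n = Assignment n → Bool

-- partial assignments {0,1,*}^n ; nothing plays the role of *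
Partial : ℕ → Set
Partial n = Fin n → Maybe Bool

total : ∀ {n} → Assignment n → Partial n
total a i = just (a i)

_⪰_ : ∀ {n} → Partial n → Partial n → Set
a ⪰ b = ∀ i ℓ → b i ≡ just ℓ → a i ≡ just ℓ

set : ∀ {n} → Partial n → Fin n → Bool → Partial n
set b i ℓ j with j ≟ i
... | yes _ = just ℓ
... | no  _ = b j

data Formula (n : ℕ) : Set where
  lit  : Fin n → Bool → Formula n      -- lit i true = x_i, lit i false = ¬x_i
  and2 : Formula n → Formula n → Formula n
  or2  : Formula n → Formula n → Formula n

litVal : Bool → Bool → Bool
litVal true  v = v
litVal false v = if v then false else true

eval : ∀ {n} → Formula n → Assignment n → Bool
eval (lit i p)  a = litVal p (a i)
eval (and2 φ ψ) a = eval φ a ∧ eval ψ a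
eval (or2 φ ψ)  a = eval φ a ∨ eval ψ a

vars : ∀ {n} → Formula n → List (Fin n)
vars (lit i p)  = i ∷ []
vars (and2 φ ψ) = vars φ ++ vars ψ
vars (or2 φ ψ)  = vars φ ++ vars ψ

IsReadOnce : ∀ {n} → Formula n → Set
IsReadOnce φ = Unique (vars φ)

ReadOnceFunction : ∀ {n} → BoolFun n → Set
ReadOnceFunction {n} f =
  Σ (Formula n) λ φ → IsReadOnce φ × (∀ a → eval φ a ≡ f a)

Literal : ℕ → Set
Literal n = Fin n × Bool

litTrue : ∀ {n} → Assignment n → Literal n → Set
litTrue a (i , p) = litVal p (a i) ≡ true

-- a term (conjunction of literals) / clause (disjunction of literals)
Term : ℕ → Set
Term n = List (Literal n)

DNFtrue : ∀ {n} → List (Term n) → Assignment n → Set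
DNFtrue ts a = Any (All (litTrue a)) ts

CNFtrue : ∀ {n} → List (Term n) → Assignment n → Set
CNFtrue cs a = All (Any (litTrue a)) cs

DNFcomputes : ∀ {n} → List (Term n) → BoolFun n → Set
DNFcomputes ts f = ∀ a → (DNFtrue ts a ⇔ (f a ≡ true))

CNFcomputes : ∀ {n} → List (Term n) → BoolFun n → Set
CNFcomputes cs f = ∀ a → (CNFtrue cs a ⇔ (f a ≡ true))

IsDS : ∀ {n} → BoolFun n → ℕ → Set
IsDS {n} f k =
  (Σ (List (Term n)) λ ts → DNFcomputes ts f × length ts ≡ k)
  × (∀ ts → DNFcomputes ts f → k ≤ length ts)

IsCS : ∀ {n} → BoolFun n → ℕ → Set
IsCS {n} f k =
  (Σ (List (Term n)) λ cs → CNFcomputes cs f × length cs ≡ k)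
  × (∀ cs → CNFcomputes cs f → k ≤ length cs)

IsCertificate : ∀ {n} → BoolFun n → Partial n → Set
IsCertificate f b =
  (∀ a → total a ⪰ b → f a ≡ false) ⊎ (∀ a → total a ⪰ b → f a ≡ true)

ContainsCertificate : ∀ {n} → BoolFun n → Partial n → Set
ContainsCertificate f b = ∃ λ c → b ⪰ c × IsCertificate f c

Monotone : ∀ {n} → (Partial n → ℕ) → Set
Monotone g = ∀ b i ℓ → b i ≡ nothing → g b ≤ g (set b i ℓ)

-- g(b_{i←ℓ}) − g(b) ≥ g(b'_{i←ℓ}) − g(b'), written without subtraction
Submodular : ∀ {n} → (Partial n → ℕ) → Set
Submodular g = ∀ b b' i ℓ → b' ⪰ b → b i ≡ nothing → b' i ≡ nothing →
  g (set b' i ℓ) + g b ≤ g (set b i ℓ) + g b'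

IsGoalFunction : ∀ {n} → BoolFun n → (Partial n → ℕ) → ℕ → Set
IsGoalFunction f g Q =
  Monotone g × Submodular g
  × (∀ a → g (total a) ≡ Q)
  × (∀ b → (g b ≡ Q) ⇔ ContainsCertificate f b)

IsGamma : ∀ {n} → BoolFun n → ℕ → Set
IsGamma {n} f k =
  (Σ (Partial n → ℕ) λ g → IsGoalFunction f g k)
  × (∀ g Q → IsGoalFunction f g Q → k ≤ Q)

-- Upper bound: from a DNF with d terms and a CNF with c clauses, b ↦ d·c − (terms not yet
-- falsified by b)·(clauses not yet satisfied by b) is a goal function with goal value d·c.
--
-- Lower bound: restricting a read-once formula φ by b leaves a formula whose canonical DNF and
-- CNF have D(b) terms and C(b) clauses, with D·C ≥ ds·cs at the empty assignment. For a goal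
-- function g with value Q, D(b)·C(b) + g(b) ≤ Q by induction on the free variables of b: unless
-- φ|b is constant or a single literal, read-onceness provides disjoint extensions L, R of b that
-- jointly force φ|b while D·C(b) ≤ D·C(L ∪ b) + D·C(R ∪ b), and submodularity of g gives
-- Q + g(b) ≤ g(L ∪ b) + g(R ∪ b).
module Submission where

open import Defs
open import Data.Nat using (ℕ; _+_; _*_; _∸_; _≤_; _<_; z≤n; s≤s)
open import Data.Nat.Properties hiding (_≟_)
open import Data.Nat.Tactic.RingSolver using (solve-∀)
open import Data.Bool using (Bool; true; false; not; _∧_; _∨_; T; T?; if_then_else_)
open import Data.Bool.Properties using (T-∨; ¬-not; not-¬; not-involutive; ∧-zeroʳ; ∨-zeroʳ)
  renaming (_≟_ to _≟ᵇ_)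
open import Data.Fin using (Fin; _≟_)
open import Data.Fin.Properties using (¬∀⟶∃¬)
open import Data.Maybe using (Maybe; just; nothing; _<∣>_)
import Data.Maybe as Maybe
import Data.Maybe.Properties as Maybe
open import Data.List using (List; []; _∷_; _++_; length; map; allFin; cartesianProductWith)
open import Data.Bool.ListAction using (any)
open import Data.List.Properties using (length-++; length-map)
open import Data.List.Membership.Propositional using (_∈_; find; lose)
open import Data.List.Membership.Propositional.Properties using (∈-++⁺ˡ; ∈-++⁺ʳ; ∈-allFin)
import Data.List.Membership.DecPropositional as DecMembership
open import Data.List.Relation.Binary.Disjoint.Propositional using (Disjoint)
open import Data.List.Relation.Binary.Subset.Propositional using (_⊆_)
open import Data.List.Relation.Unary.Unique.Propositional using (Unique)
open import Data.List.Relation.Unary.Unique.Propositional.Properties using (allFin⁺)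
open import Data.List.Relation.Unary.AllPairs using ([]; _∷_)
open import Data.List.Relation.Unary.Any as Any using (Any; here; there)
import Data.List.Relation.Unary.Any.Properties as Any
open import Data.List.Relation.Unary.All as All using (All; []; _∷_)
import Data.List.Relation.Unary.All.Properties as All
open import Data.Product using (Σ; ∃; _×_; _,_; proj₁; proj₂)
import Data.Product.Properties as Product
open import Data.Sum using (_⊎_; inj₁; inj₂; [_,_]′)
open import Data.Empty using (⊥; ⊥-elim)
open import Data.Unit using (⊤; tt)
open import Function using (_∘_; id)
open import Function.Bundles using (_⇔_; mk⇔; Equivalence)
open import Function.Construct.Composition using (_⇔-∘_)
open import Data.Product.Function.NonDependent.Propositional using (_×-⇔_)
open import Data.Sum.Function.Propositional using (_⊎-⇔_)
open import Relation.Nullary using (¬_; yes; no; Dec; contradiction)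
open import Relation.Unary using (Decidable)
open import Relation.Nullary.Decidable using (isYes; toWitness; fromWitness)
open import Relation.Binary.PropositionalEquality
import Relation.Binary.Construct.On as On
import Induction.WellFounded as WF
open import Data.Nat.Induction using (<-wellFounded)

module _ {n : ℕ} where

  ⪰-refl : (b : Partial n) → b ⪰ b
  ⪰-refl b i ℓ eq = eq

  ⪰-trans : {a b c : Partial n} → a ⪰ b → b ⪰ c → a ⪰ c
  ⪰-trans a⪰b b⪰c i ℓ eq = a⪰b i ℓ (b⪰c i ℓ eq)

  set-same : (b : Partial n) (i : Fin n) (ℓ : Bool) → set b i ℓ i ≡ just ℓ
  set-same b i ℓ with i ≟ i
  ... | yes _ = refl
  ... | no i≢i = contradiction refl i≢i

  set-other : (b : Partial n) (i : Fin n) (ℓ : Bool) {j : Fin n} → j ≢ i → set b i ℓ j ≡ b j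
  set-other b i ℓ {j} j≢i with j ≟ i
  ... | yes j≡i = contradiction j≡i j≢i
  ... | no _ = refl

  set-⪰ : (b : Partial n) (i : Fin n) (ℓ : Bool) → b i ≡ nothing → set b i ℓ ⪰ b
  set-⪰ b i ℓ free j ℓ' eq with j ≟ i
  ... | yes refl = contradiction (trans (sym free) eq) λ ()
  ... | no _ = eq

  set-unassigned-dom : ∀ {i j : Fin n} {ℓ w} → set (λ _ → nothing) i ℓ j ≡ just w → j ≡ i
  set-unassigned-dom {i} {j} eq with j ≟ i
  ... | yes j≡i = j≡i

  set-mono : {b b' : Partial n} (i : Fin n) (ℓ : Bool) → b' ⪰ b → set b' i ℓ ⪰ set b i ℓ
  set-mono {b} {b'} i ℓ b'⪰b j ℓ' eq with j ≟ i
  ... | yes _ = eq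
  ... | no _ = b'⪰b j ℓ' eq

not-≢ : ∀ v → not v ≢ v
not-≢ true ()
not-≢ false ()

litVal-false-≢ : ∀ v → litVal false v ≢ v
litVal-false-≢ true ()
litVal-false-≢ false ()

module _ {n : ℕ} where

  litAt : Assignment n → Literal n → Bool
  litAt a (i , p) = litVal p (a i)

  litTrue⇒litAt : ∀ a l → litTrue a l → litAt a l ≡ true
  litTrue⇒litAt a (i , p) eq = eq

  litAt⇒litTrue : ∀ a l → litAt a l ≡ true → litTrue a l
  litAt⇒litTrue a (i , p) eq = eq

  litUnder : Partial n → Literal n → Maybe Bool
  litUnder b (i , p) = Maybe.map (litVal p) (b i)

  negLit : Literal n → Literal n
  negLit (i , p) = i , not p

  open DecMembership {A = Literal n} (Product.≡-dec _≟_ _≟ᵇ_) using (_∈?_)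

  fixes : Bool → Partial n → Literal n → Bool
  fixes v b l = isYes (Maybe.≡-dec _≟ᵇ_ (litUnder b l) (just v))

  clashes : Term n → Bool
  clashes C = any (λ l → isYes (negLit l ∈? C)) C

  -- A clause C is satisfied by every extension of b iff decides true b C, and a term
  -- is falsified by every extension of b iff decides false b C.
  decides : Bool → Partial n → Term n → Bool
  decides v b C = any (fixes v b) C ∨ clashes C

  data Decision (v : Bool) (b : Partial n) (C : Term n) : Set where
    fixed : Any (λ l → litUnder b l ≡ just v) C → Decision v b C
    clash : ∀ {l} → l ∈ C → negLit l ∈ C → Decision v b C

  decision : ∀ {v} b {C} → T (decides v b C) → Decision v b C
  decision {v} b {C} t with Equivalence.to T-∨ t
  ... | inj₁ t' = fixed (Any.map toWitness (Any.any⁻ (fixes v b) C t'))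
  ... | inj₂ t' with find (Any.any⁻ _ C t')
  ...   | _ , l∈C , ¬l∈C = clash l∈C (toWitness ¬l∈C)

  decided : ∀ {v} b {C} → Decision v b C → T (decides v b C)
  decided b (fixed fx) = Equivalence.from T-∨ (inj₁ (Any.any⁺ _ (Any.map fromWitness fx)))
  decided b (clash l∈C ¬l∈C) = Equivalence.from T-∨ (inj₂ (Any.any⁺ _ (lose l∈C (fromWitness ¬l∈C))))

  litUnder-mono : ∀ {b b' : Partial n} {v} → b' ⪰ b → ∀ l → litUnder b l ≡ just v → litUnder b' l ≡ just v
  litUnder-mono {b} b'⪰b (i , p) eq with b i in bi
  ... | just x rewrite b'⪰b i x bi = eq

  decides-mono : ∀ (b b' : Partial n) v C → b' ⪰ b → T (decides v b C) → T (decides v b' C)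
  decides-mono b b' v C b'⪰b t with decision b t
  ... | fixed fx = decided b' {C} (fixed (Any.map (λ {l} → litUnder-mono b'⪰b l) fx))
  ... | clash l∈C ¬l∈C = decided b' {C} (clash l∈C ¬l∈C)

  litUnder-set : ∀ (b b' : Partial n) i ℓ {v} l → litUnder (set b' i ℓ) l ≡ just v →
                 litUnder b' l ≡ just v ⊎ litUnder (set b i ℓ) l ≡ just v
  litUnder-set b b' i ℓ (j , p) eq with j ≟ i
  ... | yes _ = inj₂ eq
  ... | no _ = inj₁ eq

  -- The literal deciding C for set b' i ℓ must be on x_i.
  decides-set : ∀ (b b' : Partial n) i ℓ v C → T (decides v (set b' i ℓ) C) → ¬ T (decides v b' C) →
                T (decides v (set b i ℓ) C)
  decides-set b b' i ℓ v C t ¬t' with decision (set b' i ℓ) t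
  ... | clash l∈C ¬l∈C = decided (set b i ℓ) {C} (clash l∈C ¬l∈C)
  ... | fixed fx with Any.Any-⊎⁻ (Any.map (λ {l} → litUnder-set b b' i ℓ l) fx)
  ...   | inj₁ fx' = contradiction (decided b' {C} (fixed fx')) ¬t'
  ...   | inj₂ fx' = decided (set b i ℓ) {C} (fixed fx')

  litAt-neg : ∀ a (l : Literal n) → litAt a (negLit l) ≡ not (litAt a l)
  litAt-neg a (i , p) with a i
  litAt-neg a (i , true)  | true = refl
  litAt-neg a (i , true)  | false = refl
  litAt-neg a (i , false) | true = refl
  litAt-neg a (i , false) | false = refl

  decides-sound : ∀ {a b v C} → total a ⪰ b → T (decides v b C) → Any (λ l → litAt a l ≡ v) C
  decides-sound {a} {b} {v} a⪰b t with decision b t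
  ... | fixed fx = Any.map (λ {l} eq → Maybe.just-injective (litUnder-mono a⪰b l eq)) fx
  ... | clash {l} l∈C ¬l∈C with litAt a l ≟ᵇ v
  ...   | yes eq = lose l∈C eq
  ...   | no neq = lose ¬l∈C (trans (litAt-neg a l) (trans (cong not (¬-not neq)) (not-involutive v)))

  decides-total : ∀ {a v C l} → l ∈ C → litAt a l ≡ v → T (decides v (total a) C)
  decides-total {a} {v} {C} l∈C eq = decided (total a) {C} (fixed (lose l∈C (cong just eq)))

  -- Free variables are set so that the literals of C on them (of one sign only, as C does not
  -- clash) avoid v.
  avoiding : Bool → Partial n → Term n → Assignment n
  avoiding v b C j with b j
  ... | just x = x
  ... | nothing = if isYes ((j , true) ∈? C) then not v else v

  avoiding-⪰ : ∀ v b C → total (avoiding v b C) ⪰ b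
  avoiding-⪰ v b C j ℓ eq with b j
  avoiding-⪰ v b C j ℓ refl | just .ℓ = refl

  avoiding-avoids : ∀ v b C → ¬ T (decides v b C) → All (λ l → litAt (avoiding v b C) l ≢ v) C
  avoiding-avoids v b C ¬t = All.tabulate avoids
    where
    avoids : ∀ {l} → l ∈ C → litAt (avoiding v b C) l ≢ v
    avoids {j , p} l∈C with b j in bj
    ... | just x = λ eq →
      ¬t (decided b {C} (fixed (lose l∈C (trans (cong (Maybe.map (litVal p)) bj) (cong just eq)))))
    ... | nothing with (j , true) ∈? C | p
    ...   | yes _ | true = not-≢ v
    ...   | yes j∈C | false = λ _ → ¬t (decided b {C} (clash l∈C j∈C))
    ...   | no j∉C | true = contradiction l∈C j∉C
    ...   | no _ | false = litVal-false-≢ v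

falseIndicator : Bool → ℕ
falseIndicator v = if v then 0 else 1

falseIndicator-anti : ∀ u u' → (T u → T u') → falseIndicator u' ≤ falseIndicator u
falseIndicator-anti true true _ = ≤-refl
falseIndicator-anti true false imp = contradiction (imp tt) λ ()
falseIndicator-anti false true _ = z≤n
falseIndicator-anti false false _ = ≤-refl

countFalse : {A : Set} → (A → Bool) → List A → ℕ
countFalse h [] = 0
countFalse h (x ∷ xs) = falseIndicator (h x) + countFalse h xs

module _ {A : Set} where

  countFalse≤length : (h : A → Bool) (xs : List A) → countFalse h xs ≤ length xs
  countFalse≤length h [] = z≤n
  countFalse≤length h (x ∷ xs) with h x
  ... | true = m≤n⇒m≤1+n (countFalse≤length h xs)
  ... | false = s≤s (countFalse≤length h xs)

  countFalse-anti : (h h' : A → Bool) (xs : List A) → (∀ x → T (h x) → T (h' x)) →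
                    countFalse h' xs ≤ countFalse h xs
  countFalse-anti h h' [] h⇒h' = z≤n
  countFalse-anti h h' (x ∷ xs) h⇒h' =
    +-mono-≤ (falseIndicator-anti (h x) (h' x) (h⇒h' x)) (countFalse-anti h h' xs h⇒h')

  countFalse-strict : (h h' : A → Bool) {xs : List A} {x : A} → (∀ x → T (h x) → T (h' x)) →
                      x ∈ xs → ¬ T (h x) → T (h' x) → countFalse h' xs < countFalse h xs
  countFalse-strict h h' {y ∷ xs} h⇒h' (here refl) ¬hx h'x with h y | h' y
  ... | false | true = s≤s (countFalse-anti h h' xs h⇒h')
  ... | true | _ = contradiction tt ¬hx
  countFalse-strict h h' {y ∷ xs} h⇒h' (there x∈) ¬hx h'x =
    +-mono-≤-< (falseIndicator-anti (h y) (h' y) (h⇒h' y)) (countFalse-strict h h' h⇒h' x∈ ¬hx h'x)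

  countFalse≡0⇒All : (h : A → Bool) (xs : List A) → countFalse h xs ≡ 0 → All (T ∘ h) xs
  countFalse≡0⇒All h [] _ = []
  countFalse≡0⇒All h (x ∷ xs) eq with h x in hx
  ... | true = subst T (sym hx) tt ∷ countFalse≡0⇒All h xs eq

  All⇒countFalse≡0 : (h : A → Bool) {xs : List A} → All (T ∘ h) xs → countFalse h xs ≡ 0
  All⇒countFalse≡0 h [] = refl
  All⇒countFalse≡0 h {x ∷ xs} (hx ∷ hxs) with h x
  ... | true = All⇒countFalse≡0 h hxs

-- The numbers of undecided clauses at b, b_{i←ℓ}, b' and b'_{i←ℓ} (with b' ⪰ b) have the shape
-- (U+q+a+p, U+q, U+a, U); this records u − ux ≥ u' − u'x without subtraction.
record Diminishing (u ux u' u'x : ℕ) : Set where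
  constructor diminishing
  field
    U q a p : ℕ
    u'x≡ : u'x ≡ U
    u'≡ : u' ≡ U + a
    ux≡ : ux ≡ U + q
    u≡ : u ≡ U + q + a + p

diminishing-zero : Diminishing 0 0 0 0
diminishing-zero = diminishing 0 0 0 0 refl refl refl refl

diminishing-+ : ∀ {u ux u' u'x v vx v' v'x} → Diminishing u ux u' u'x → Diminishing v vx v' v'x →
                Diminishing (u + v) (ux + vx) (u' + v') (u'x + v'x)
diminishing-+ (diminishing U q a p refl refl refl refl) (diminishing V r c s refl refl refl refl) =
  diminishing (U + V) (q + r) (a + c) (p + s) refl (shuffle₂ U a V c) (shuffle₂ U q V r)
    (shuffle₄ U q a p V r c s)
  where
  shuffle₂ : ∀ U a V c → (U + a) + (V + c) ≡ (U + V) + (a + c)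
  shuffle₂ = solve-∀
  shuffle₄ : ∀ U q a p V r c s →
             (U + q + a + p) + (V + r + c + s) ≡ (U + V) + (q + r) + (a + c) + (p + s)
  shuffle₄ = solve-∀

diminishing-* : ∀ {u ux u' u'x w wx w' w'x} → Diminishing u ux u' u'x → Diminishing w wx w' w'x →
                ux * wx + u' * w' ≤ u'x * w'x + u * w
diminishing-* (diminishing U q a p refl refl refl refl) (diminishing W t b r refl refl refl refl) =
  subst (lhs ≤_) (expand U W a q p b t r) (m≤m+n lhs _)
  where
  lhs = (U + q) * (W + t) + (U + a) * (W + b)
  expand : ∀ U W a q p b t r →
           ((U + q) * (W + t) + (U + a) * (W + b))
             + (U * r + q * b + q * r + a * t + a * r + p * (W + t + b + r))
           ≡ U * W + (U + q + a + p) * (W + t + b + r)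
  expand = solve-∀

countFalse-diminishing :
  ∀ {A : Set} (h h₁ h' h'₁ : A → Bool) (xs : List A) →
  (∀ x → T (h x) → T (h₁ x)) → (∀ x → T (h x) → T (h' x)) →
  (∀ x → T (h₁ x) → T (h'₁ x)) → (∀ x → T (h' x) → T (h'₁ x)) →
  (∀ x → T (h'₁ x) → ¬ T (h' x) → T (h₁ x)) →
  Diminishing (countFalse h xs) (countFalse h₁ xs) (countFalse h' xs) (countFalse h'₁ xs)
countFalse-diminishing h h₁ h' h'₁ [] _ _ _ _ _ = diminishing-zero
countFalse-diminishing h h₁ h' h'₁ (x ∷ xs) c₁ c₂ c₃ c₄ c₅ =
  diminishing-+ (indicators (h x) (h₁ x) (h' x) (h'₁ x) (c₁ x) (c₂ x) (c₃ x) (c₄ x) (c₅ x))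
                (countFalse-diminishing h h₁ h' h'₁ xs c₁ c₂ c₃ c₄ c₅)
  where
  indicators : ∀ v v₁ v' v'₁ → (T v → T v₁) → (T v → T v') → (T v₁ → T v'₁) → (T v' → T v'₁) →
               (T v'₁ → ¬ T v' → T v₁) →
               Diminishing (falseIndicator v) (falseIndicator v₁) (falseIndicator v') (falseIndicator v'₁)
  indicators true true true true _ _ _ _ _ = diminishing 0 0 0 0 refl refl refl refl
  indicators true false _ _ c _ _ _ _ = contradiction (c tt) λ ()
  indicators true true false _ _ c _ _ _ = contradiction (c tt) λ ()
  indicators true true true false _ _ c _ _ = contradiction (c tt) λ ()
  indicators false true true true _ _ _ _ _ = diminishing 0 0 0 1 refl refl refl refl
  indicators false true false true _ _ _ _ _ = diminishing 0 0 1 0 refl refl refl refl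
  indicators false false true true _ _ _ _ _ = diminishing 0 1 0 0 refl refl refl refl
  indicators false false false false _ _ _ _ _ = diminishing 1 0 0 0 refl refl refl refl
  indicators false true _ false _ _ c _ _ = contradiction (c tt) λ ()
  indicators false false true false _ _ _ c _ = contradiction (c tt) λ ()
  indicators false false false true _ _ _ _ c = contradiction (c tt λ ()) λ ()

∸-submodular : ∀ Q A B C D → A ≤ Q → B ≤ Q → C ≤ Q → D ≤ Q → C + D ≤ A + B →
               (Q ∸ A) + (Q ∸ B) ≤ (Q ∸ C) + (Q ∸ D)
∸-submodular Q A B C D A≤Q B≤Q C≤Q D≤Q CD≤AB = +-cancelʳ-≤ (C + D) _ _ (begin
  ((Q ∸ A) + (Q ∸ B)) + (C + D)   ≤⟨ +-monoʳ-≤ ((Q ∸ A) + (Q ∸ B)) CD≤AB ⟩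
  ((Q ∸ A) + (Q ∸ B)) + (A + B)   ≡⟨ shuffle (Q ∸ A) (Q ∸ B) A B ⟩
  ((Q ∸ A) + A) + ((Q ∸ B) + B)   ≡⟨ cong₂ _+_ (m∸n+n≡m A≤Q) (m∸n+n≡m B≤Q) ⟩
  Q + Q                           ≡⟨ sym (cong₂ _+_ (m∸n+n≡m C≤Q) (m∸n+n≡m D≤Q)) ⟩
  ((Q ∸ C) + C) + ((Q ∸ D) + D)   ≡⟨ sym (shuffle (Q ∸ C) (Q ∸ D) C D) ⟩
  ((Q ∸ C) + (Q ∸ D)) + (C + D)   ∎)
  where
  open ≤-Reasoning
  shuffle : ∀ a b c d → (a + b) + (c + d) ≡ (a + c) + (b + d)
  shuffle = solve-∀

∸≡⇒≡0 : ∀ {Q x} → x ≤ Q → Q ∸ x ≡ Q → x ≡ 0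
∸≡⇒≡0 {Q} {x} x≤Q eq =
  +-cancelˡ-≡ Q x 0 (trans (trans (cong (_+ x) (sym eq)) (m∸n+n≡m x≤Q)) (sym (+-identityʳ Q)))

module ProductGoal {n : ℕ} (f : BoolFun n) (ts cs : List (Term n))
                   (dnf : DNFcomputes ts f) (cnf : CNFcomputes cs f) where

  Q : ℕ
  Q = length ts * length cs

  liveTerms liveClauses : Partial n → ℕ
  liveTerms b = countFalse (decides false b) ts
  liveClauses b = countFalse (decides true b) cs

  live : Partial n → ℕ
  live b = liveTerms b * liveClauses b

  goal : Partial n → ℕ
  goal b = Q ∸ live b

  live≤Q : ∀ b → live b ≤ Q
  live≤Q b = *-mono-≤ (countFalse≤length _ ts) (countFalse≤length _ cs)

  live-anti : ∀ b b' → b' ⪰ b → live b' ≤ live b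
  live-anti b b' b'⪰b =
    *-mono-≤ (countFalse-anti (decides false b) (decides false b') ts λ C → decides-mono b b' _ C b'⪰b)
             (countFalse-anti (decides true b) (decides true b') cs λ C → decides-mono b b' _ C b'⪰b)

  goal-monotone : Monotone goal
  goal-monotone b i ℓ free = ∸-monoʳ-≤ Q (live-anti b (set b i ℓ) (set-⪰ b i ℓ free))

  goal-submodular : Submodular goal
  goal-submodular b b' i ℓ b'⪰b free free' =
    ∸-submodular Q (live (set b' i ℓ)) (live b) (live (set b i ℓ)) (live b')
      (live≤Q (set b' i ℓ)) (live≤Q b) (live≤Q (set b i ℓ)) (live≤Q b')
      (diminishing-* (liveCount false ts) (liveCount true cs))
    where
    liveCount : ∀ v Cs → Diminishing (countFalse (decides v b) Cs) (countFalse (decides v (set b i ℓ)) Cs)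
                                     (countFalse (decides v b') Cs) (countFalse (decides v (set b' i ℓ)) Cs)
    liveCount v Cs =
      countFalse-diminishing (decides v b) (decides v (set b i ℓ)) (decides v b') (decides v (set b' i ℓ)) Cs
      (λ C → decides-mono b (set b i ℓ) v C (set-⪰ b i ℓ free))
      (λ C → decides-mono b b' v C b'⪰b)
      (λ C → decides-mono (set b i ℓ) (set b' i ℓ) v C (set-mono i ℓ b'⪰b))
      (λ C → decides-mono b' (set b' i ℓ) v C (set-⪰ b' i ℓ free'))
      (decides-set b b' i ℓ v)

  goal-total : ∀ a → goal (total a) ≡ Q
  goal-total a with f a in fa
  ... | true = cong (Q ∸_) (trans (cong (liveTerms (total a) *_) clauses-closed) (*-zeroʳ (liveTerms (total a))))
    where
    clauses-closed : liveClauses (total a) ≡ 0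
    clauses-closed = All⇒countFalse≡0 _ (All.map (λ sat → decides-total′ sat)
                       (Equivalence.from (cnf a) fa))
      where
      decides-total′ : ∀ {C} → Any (litTrue a) C → T (decides true (total a) C)
      decides-total′ sat with find sat
      ... | l , l∈C , eq = decides-total {l = l} l∈C (litTrue⇒litAt a l eq)
  ... | false = cong (Q ∸_) (cong (_* liveClauses (total a)) terms-closed)
    where
    terms-closed : liveTerms (total a) ≡ 0
    terms-closed = All⇒countFalse≡0 _ (All.tabulate refuted)
      where
      refuted : ∀ {t} → t ∈ ts → T (decides false (total a) t)
      refuted {t} t∈ts with All.¬All⇒Any¬ (λ l → litAt a l ≟ᵇ true) t
                              (λ all → not-¬ (Equivalence.to (dnf a) (lose t∈ts (allTrue all))) fa)
        where
        allTrue : All (λ l → litAt a l ≡ true) t → All (litTrue a) t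
        allTrue = All.map λ {l} → litAt⇒litTrue a l
      ... | ¬true with find ¬true
      ...   | (i , p) , l∈t , ne = decides-total {l = i , p} l∈t (¬-not ne)

  goal≡Q⇒certificate : ∀ b → goal b ≡ Q → ContainsCertificate f b
  goal≡Q⇒certificate b eq with m*n≡0⇒m≡0∨n≡0 (liveTerms b) (∸≡⇒≡0 (live≤Q b) eq)
  ... | inj₁ noTerm = b , ⪰-refl b , inj₁ λ a a⪰b → ¬-not λ fa →
          let t , t∈ts , allTrue = find (Equivalence.from (dnf a) fa)
              l , l∈t , eq' = refutedLiteral a a⪰b t∈ts
          in contradiction (trans (sym eq') (litTrue⇒litAt a l (All.lookup allTrue l∈t))) λ ()
    where
    refutedLiteral : ∀ a → total a ⪰ b → ∀ {t} → t ∈ ts → Σ (Literal n) λ l → l ∈ t × litAt a l ≡ false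
    refutedLiteral a a⪰b t∈ts =
      find (decides-sound a⪰b (All.lookup (countFalse≡0⇒All _ ts noTerm) t∈ts))
  ... | inj₂ noClause = b , ⪰-refl b , inj₂ λ a a⪰b →
          Equivalence.to (cnf a) (All.map (λ t → Any.map (λ {l} → litAt⇒litTrue a l) (decides-sound a⪰b t))
                                          (countFalse≡0⇒All _ cs noClause))

  certificate⇒goal≡Q : ∀ b → ContainsCertificate f b → goal b ≡ Q
  certificate⇒goal≡Q b (c , b⪰c , inj₁ forcesFalse) =
    cong (λ k → Q ∸ k * liveClauses b) (All⇒countFalse≡0 _ (All.tabulate refuted))
    where
    refuted : ∀ {t} → t ∈ ts → T (decides false b t)
    refuted {t} t∈ts with T? (decides false b t)
    ... | yes d = d
    ... | no ¬d = contradiction (Equivalence.to (dnf a) (lose t∈ts allTrue))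
                    (not-¬ (forcesFalse a (⪰-trans (avoiding-⪰ false b t) b⪰c)))
      where
      a = avoiding false b t
      allTrue : All (litTrue a) t
      allTrue = All.map (λ {l} ne → litAt⇒litTrue a l (¬-not ne)) (avoiding-avoids false b t ¬d)
  certificate⇒goal≡Q b (c , b⪰c , inj₂ forcesTrue) =
    cong (Q ∸_) (trans (cong (liveTerms b *_) (All⇒countFalse≡0 _ (All.tabulate satisfied)))
                       (*-zeroʳ (liveTerms b)))
    where
    satisfied : ∀ {C} → C ∈ cs → T (decides true b C)
    satisfied {C} C∈cs with T? (decides true b C)
    ... | yes d = d
    ... | no ¬d with find (All.lookup (Equivalence.from (cnf a) (forcesTrue a (⪰-trans (avoiding-⪰ true b C) b⪰c)))
                                      C∈cs)
      where
      a = avoiding true b C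
    ...   | l , l∈C , lt =
      contradiction (litTrue⇒litAt (avoiding true b C) l lt) (All.lookup (avoiding-avoids true b C ¬d) l∈C)

  isGoalFunction : IsGoalFunction f goal Q
  isGoalFunction = goal-monotone , goal-submodular , goal-total ,
                   λ b → mk⇔ (goal≡Q⇒certificate b) (certificate⇒goal≡Q b)

module _ {A : Set} where

  length-cartesianProductWith : ∀ {B C : Set} (f : A → B → C) xs ys →
                                length (cartesianProductWith f xs ys) ≡ length xs * length ys
  length-cartesianProductWith f [] ys = refl
  length-cartesianProductWith f (x ∷ xs) ys = begin
    length (map (f x) ys ++ cartesianProductWith f xs ys)       ≡⟨ length-++ (map (f x) ys) ⟩
    length (map (f x) ys) + length (cartesianProductWith f xs ys) ≡⟨ cong₂ _+_ (length-map (f x) ys)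
                                                                  (length-cartesianProductWith f xs ys) ⟩
    length ys + length xs * length ys                            ∎
    where open ≡-Reasoning

  -- Pairwise unions of clauses form a CNF of the disjunction.
  All-Any-cartesian-++ : {P : A → Set} → Decidable P → ∀ (xs ys : List (List A)) →
                         All (Any P) (cartesianProductWith _++_ xs ys) ⇔ (All (Any P) xs ⊎ All (Any P) ys)
  All-Any-cartesian-++ {P} P? xs ys = mk⇔ (to xs) [ fromˡ xs , fromʳ xs ]′
    where
    fromˡ : ∀ xs → All (Any P) xs → All (Any P) (cartesianProductWith _++_ xs ys)
    fromˡ [] [] = []
    fromˡ (x ∷ xs) (px ∷ pxs) = All.++⁺ (All.map⁺ (All.tabulate λ _ → Any.++⁺ˡ px)) (fromˡ xs pxs)
    fromʳ : ∀ xs → All (Any P) ys → All (Any P) (cartesianProductWith _++_ xs ys)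
    fromʳ [] pys = []
    fromʳ (x ∷ xs) pys = All.++⁺ (All.map⁺ (All.map (Any.++⁺ʳ x) pys)) (fromʳ xs pys)
    to : ∀ xs → All (Any P) (cartesianProductWith _++_ xs ys) → All (Any P) xs ⊎ All (Any P) ys
    to [] _ = inj₁ []
    to (x ∷ xs) pxys with Any.any? P? x | to xs (All.++⁻ʳ (map (x ++_) ys) pxys)
    ... | yes px | inj₁ pxs = inj₁ (px ∷ pxs)
    ... | yes _ | inj₂ pys = inj₂ pys
    ... | no ¬px | _ = inj₂ (All.map (λ {y} → [ (λ px → contradiction px ¬px) , (λ py → py) ]′ ∘ Any.++⁻ x)
                                     (All.map⁻ (All.++⁻ˡ (map (x ++_) ys) pxys)))

module _ {n : ℕ} where

  dnf cnf : Formula n → List (Term n)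
  dnf (lit i p) = ((i , p) ∷ []) ∷ []
  dnf (and2 φ ψ) = cartesianProductWith _++_ (dnf φ) (dnf ψ)
  dnf (or2 φ ψ) = dnf φ ++ dnf ψ
  cnf (lit i p) = ((i , p) ∷ []) ∷ []
  cnf (and2 φ ψ) = cnf φ ++ cnf ψ
  cnf (or2 φ ψ) = cartesianProductWith _++_ (cnf φ) (cnf ψ)

  module _ (a : Assignment n) where

    ×⇔∧ : ∀ {x y} → (x ≡ true × y ≡ true) ⇔ (x ∧ y ≡ true)
    ×⇔∧ {true} = mk⇔ proj₂ (λ eq → refl , eq)
    ×⇔∧ {false} = mk⇔ (λ ()) (λ ())

    ⊎⇔∨ : ∀ {x y} → (x ≡ true ⊎ y ≡ true) ⇔ (x ∨ y ≡ true)
    ⊎⇔∨ {true} = mk⇔ (λ _ → refl) inj₁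
    ⊎⇔∨ {false} = mk⇔ [ (λ ()) , (λ eq → eq) ]′ inj₂

    dnf-sound-complete : ∀ φ → DNFtrue (dnf φ) a ⇔ (eval φ a ≡ true)
    dnf-sound-complete (lit i p) = mk⇔ (λ { (here (eq ∷ [])) → eq }) (λ eq → here (eq ∷ []))
    dnf-sound-complete (and2 φ ψ) =
      ×⇔∧ ⇔-∘ ((dnf-sound-complete φ ×-⇔ dnf-sound-complete ψ) ⇔-∘
        mk⇔ (Any.cartesianProductWith⁻ _++_ (All.++⁻ _) (dnf φ) (dnf ψ))
            (λ (t , u) → Any.cartesianProductWith⁺ _++_ All.++⁺ t u))
    dnf-sound-complete (or2 φ ψ) =
      ⊎⇔∨ ⇔-∘ ((dnf-sound-complete φ ⊎-⇔ dnf-sound-complete ψ) ⇔-∘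
        mk⇔ (Any.++⁻ (dnf φ)) [ Any.++⁺ˡ , Any.++⁺ʳ (dnf φ) ]′)

    cnf-sound-complete : ∀ φ → CNFtrue (cnf φ) a ⇔ (eval φ a ≡ true)
    cnf-sound-complete (lit i p) = mk⇔ (λ { (here eq ∷ []) → eq }) (λ eq → here eq ∷ [])
    cnf-sound-complete (and2 φ ψ) =
      ×⇔∧ ⇔-∘ ((cnf-sound-complete φ ×-⇔ cnf-sound-complete ψ) ⇔-∘
        mk⇔ (All.++⁻ (cnf φ)) (λ (t , u) → All.++⁺ t u))
    cnf-sound-complete (or2 φ ψ) =
      ⊎⇔∨ ⇔-∘ ((cnf-sound-complete φ ⊎-⇔ cnf-sound-complete ψ) ⇔-∘
        All-Any-cartesian-++ (λ l → litAt a l ≟ᵇ true) (cnf φ) (cnf ψ))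

  dnf-computes : ∀ φ {f : BoolFun n} → (∀ a → eval φ a ≡ f a) → DNFcomputes (dnf φ) f
  dnf-computes φ φ≡f a = subst (λ x → DNFtrue (dnf φ) a ⇔ (x ≡ true)) (φ≡f a) (dnf-sound-complete a φ)

  cnf-computes : ∀ φ {f : BoolFun n} → (∀ a → eval φ a ≡ f a) → CNFcomputes (cnf φ) f
  cnf-computes φ φ≡f a = subst (λ x → CNFtrue (cnf φ) a ⇔ (x ≡ true)) (φ≡f a) (cnf-sound-complete a φ)

-- The restriction of a read-once formula by a partial assignment, up to what Γ sees: either a
-- constant, or `sized d c` when it is not constant and its canonical DNF and CNF (dnf, cnf with
-- the constants absorbed) have d terms and c clauses.
data Residual : Set where
  const : Bool → Residual
  sized : ℕ → ℕ → Residual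

andʳ : Residual → Residual → Residual
andʳ (const false) y = const false
andʳ (const true) y = y
andʳ (sized d c) (const false) = const false
andʳ (sized d c) (const true) = sized d c
andʳ (sized d c) (sized d' c') = sized (d * d') (c + c')

orʳ : Residual → Residual → Residual
orʳ (const true) y = const true
orʳ (const false) y = y
orʳ (sized d c) (const true) = const true
orʳ (sized d c) (const false) = sized d c
orʳ (sized d c) (sized d' c') = sized (d + d') (c * c')

negʳ : Residual → Residual
negʳ (const v) = const (not v)
negʳ (sized d c) = sized c d

dnfSize cnfSize sizeProduct : Residual → ℕ
dnfSize (const v) = if v then 1 else 0
dnfSize (sized d c) = d
cnfSize (const v) = if v then 0 else 1
cnfSize (sized d c) = c
sizeProduct x = dnfSize x * cnfSize x

-- In a split towards value v (see Split below) the first size survives in each piece and the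
-- second is shared out between the pieces.
keptSize sharedSize : Bool → Residual → ℕ
keptSize v = if v then dnfSize else cnfSize
sharedSize v = if v then cnfSize else dnfSize

Positive : Residual → Set
Positive (const _) = ⊤
Positive (sized d c) = 1 ≤ d × 1 ≤ c

negʳ-involutive : ∀ x → negʳ (negʳ x) ≡ x
negʳ-involutive (const v) = cong const (not-involutive v)
negʳ-involutive (sized d c) = refl

orʳ-deMorgan : ∀ x y → orʳ x y ≡ negʳ (andʳ (negʳ x) (negʳ y))
orʳ-deMorgan (const true) y = refl
orʳ-deMorgan (const false) y = sym (negʳ-involutive y)
orʳ-deMorgan (sized d c) (const true) = refl
orʳ-deMorgan (sized d c) (const false) = refl
orʳ-deMorgan (sized d c) (sized d' c') = refl

keptSize-negʳ : ∀ v x → keptSize (not v) (negʳ x) ≡ keptSize v x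
keptSize-negʳ true (const true) = refl
keptSize-negʳ true (const false) = refl
keptSize-negʳ true (sized d c) = refl
keptSize-negʳ false (const true) = refl
keptSize-negʳ false (const false) = refl
keptSize-negʳ false (sized d c) = refl

sharedSize-negʳ : ∀ v x → sharedSize (not v) (negʳ x) ≡ sharedSize v x
sharedSize-negʳ true (const true) = refl
sharedSize-negʳ true (const false) = refl
sharedSize-negʳ true (sized d c) = refl
sharedSize-negʳ false (const true) = refl
sharedSize-negʳ false (const false) = refl
sharedSize-negʳ false (sized d c) = refl

negʳ-const : ∀ x v → x ≡ const v → negʳ x ≡ const (not v)
negʳ-const x v refl = refl

negʳ-sized : ∀ {x d c} → x ≡ sized d c → negʳ x ≡ sized c d
negʳ-sized refl = refl

negʳ-const⁻ : ∀ x v → negʳ x ≡ const (not v) → x ≡ const v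
negʳ-const⁻ (const true) true eq = refl
negʳ-const⁻ (const false) false eq = refl
negʳ-const⁻ (const true) false ()
negʳ-const⁻ (const false) true ()

const? : ∀ x v → Dec (x ≡ const v)
const? (const x) v with x ≟ᵇ v
... | yes refl = yes refl
... | no x≢v = no λ { refl → x≢v refl }
const? (sized d c) v = no λ ()

sized≢const : ∀ {x d c} v → x ≡ sized d c → x ≢ const v
sized≢const v refl ()

andʳ-positive : ∀ x y → Positive x → Positive y → Positive (andʳ x y)
andʳ-positive (const true) y px py = py
andʳ-positive (const false) y px py = tt
andʳ-positive (sized d c) (const true) px py = px
andʳ-positive (sized d c) (const false) px py = tt
andʳ-positive (sized d c) (sized d' c') (1≤d , 1≤c) (1≤d' , _) = *-mono-≤ 1≤d 1≤d' , ≤-trans 1≤c (m≤m+n c c')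

negʳ-positive : ∀ x → Positive x → Positive (negʳ x)
negʳ-positive (const v) p = tt
negʳ-positive (sized d c) (1≤d , 1≤c) = 1≤c , 1≤d

dnfSize-positive : ∀ x → Positive x → x ≢ const false → 1 ≤ dnfSize x
dnfSize-positive (const true) p x≢f = ≤-refl
dnfSize-positive (const false) p x≢f = contradiction refl x≢f
dnfSize-positive (sized d c) (1≤d , _) x≢f = 1≤d

cnfSize-positive : ∀ x → Positive x → x ≢ const true → 1 ≤ cnfSize x
cnfSize-positive (const true) p x≢t = contradiction refl x≢t
cnfSize-positive (const false) p x≢t = ≤-refl
cnfSize-positive (sized d c) (_ , 1≤c) x≢t = 1≤c

dnfSize-positive⁻ : ∀ x → 1 ≤ dnfSize x → x ≢ const false
dnfSize-positive⁻ (const false) () refl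

andʳ-≢false : ∀ x y → x ≢ const false → y ≢ const false → andʳ x y ≢ const false
andʳ-≢false (const true) y x≢f y≢f eq = y≢f eq
andʳ-≢false (const false) y x≢f y≢f eq = x≢f refl
andʳ-≢false (sized d c) (const false) x≢f y≢f eq = y≢f refl
andʳ-≢false (sized d c) (const true) x≢f y≢f ()
andʳ-≢false (sized d c) (sized d' c') x≢f y≢f ()

dnfSize-andʳ : ∀ x y → x ≢ const false → y ≢ const false → dnfSize (andʳ x y) ≡ dnfSize x * dnfSize y
dnfSize-andʳ (const true) y x≢f y≢f = sym (+-identityʳ (dnfSize y))
dnfSize-andʳ (const false) y x≢f y≢f = contradiction refl x≢f
dnfSize-andʳ (sized d c) (const true) x≢f y≢f = sym (*-identityʳ d)
dnfSize-andʳ (sized d c) (const false) x≢f y≢f = contradiction refl y≢f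
dnfSize-andʳ (sized d c) (sized d' c') x≢f y≢f = refl

cnfSize-andʳ : ∀ x y → x ≢ const false → y ≢ const false → cnfSize (andʳ x y) ≡ cnfSize x + cnfSize y
cnfSize-andʳ (const true) y x≢f y≢f = refl
cnfSize-andʳ (const false) y x≢f y≢f = contradiction refl x≢f
cnfSize-andʳ (sized d c) (const true) x≢f y≢f = sym (+-identityʳ c)
cnfSize-andʳ (sized d c) (const false) x≢f y≢f = contradiction refl y≢f
cnfSize-andʳ (sized d c) (sized d' c') x≢f y≢f = refl

andʳ-true⁻ : ∀ x y → andʳ x y ≡ const true → x ≡ const true × y ≡ const true
andʳ-true⁻ (const true) y eq = refl , eq
andʳ-true⁻ (const false) y ()
andʳ-true⁻ (sized d c) (const true) ()
andʳ-true⁻ (sized d c) (const false) ()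
andʳ-true⁻ (sized d c) (sized d' c') ()

andʳ-comm : ∀ x y → andʳ x y ≡ andʳ y x
andʳ-comm (const true) (const true) = refl
andʳ-comm (const true) (const false) = refl
andʳ-comm (const false) (const true) = refl
andʳ-comm (const false) (const false) = refl
andʳ-comm (const true) (sized d c) = refl
andʳ-comm (const false) (sized d c) = refl
andʳ-comm (sized d c) (const true) = refl
andʳ-comm (sized d c) (const false) = refl
andʳ-comm (sized d c) (sized d' c') = cong₂ sized (*-comm d d') (+-comm c c')

dnfSize-andʳ-mono : ∀ x y x' y' → x ≢ const false → y ≢ const false → x' ≢ const false → y' ≢ const false →
                    dnfSize x ≤ dnfSize x' → dnfSize y ≤ dnfSize y' → dnfSize (andʳ x y) ≤ dnfSize (andʳ x' y')
dnfSize-andʳ-mono x y x' y' nx ny nx' ny' p q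
  rewrite dnfSize-andʳ x y nx ny | dnfSize-andʳ x' y' nx' ny' = *-mono-≤ p q

cnfSize-andʳ-split : ∀ x y xs ys xt yt →
                     x ≢ const false → y ≢ const false → xs ≢ const false → ys ≢ const false →
                     xt ≢ const false → yt ≢ const false →
                     cnfSize x ≤ cnfSize xs + cnfSize xt → cnfSize y ≤ cnfSize ys + cnfSize yt →
                     cnfSize (andʳ x y) ≤ cnfSize (andʳ xs ys) + cnfSize (andʳ xt yt)
cnfSize-andʳ-split x y xs ys xt yt nx ny nxs nys nxt nyt p q
  rewrite cnfSize-andʳ x y nx ny | cnfSize-andʳ xs ys nxs nys | cnfSize-andʳ xt yt nxt nyt =
  subst (cnfSize x + cnfSize y ≤_) (shuffle (cnfSize xs) (cnfSize xt) (cnfSize ys) (cnfSize yt)) (+-mono-≤ p q)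
  where
  shuffle : ∀ a b c d → (a + b) + (c + d) ≡ (a + c) + (b + d)
  shuffle = solve-∀

data Shape (x : Residual) : Set where
  isConst : ∀ w → x ≡ const w → Shape x
  nonConst : x ≢ const true → x ≢ const false → Shape x

≢const : ∀ {x} → x ≢ const true → x ≢ const false → ∀ w → x ≢ const w
≢const ≢t ≢f true = ≢t
≢const ≢t ≢f false = ≢f

shape : ∀ x → Shape x
shape (const w) = isConst w refl
shape (sized d c) = nonConst (λ ()) (λ ())

litResidual : Bool → Maybe Bool → Residual
litResidual p (just x) = const (litVal p x)
litResidual p nothing = sized 1 1

module _ {n : ℕ} where

  infixr 6 _∪_
  _∪_ : Partial n → Partial n → Partial n
  (S ∪ b) i = S i <∣> b i

  unassigned : Partial n
  unassigned i = nothing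

  residual : Formula n → Partial n → Residual
  residual (lit i p) b = litResidual p (b i)
  residual (and2 φ ψ) b = andʳ (residual φ b) (residual ψ b)
  residual (or2 φ ψ) b = orʳ (residual φ b) (residual ψ b)

  DependsOn : (Partial n → Residual) → List (Fin n) → Set
  DependsOn F X = ∀ b b' → (∀ i → i ∈ X → b i ≡ b' i) → F b ≡ F b'

  residual-local : ∀ φ → DependsOn (residual φ) (vars φ)
  residual-local (lit i p) b b' agree = cong (litResidual p) (agree i (here refl))
  residual-local (and2 φ ψ) b b' agree =
    cong₂ andʳ (residual-local φ b b' λ i → agree i ∘ ∈-++⁺ˡ)
               (residual-local ψ b b' λ i → agree i ∘ ∈-++⁺ʳ (vars φ))
  residual-local (or2 φ ψ) b b' agree =
    cong₂ orʳ (residual-local φ b b' λ i → agree i ∘ ∈-++⁺ˡ)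
              (residual-local ψ b b' λ i → agree i ∘ ∈-++⁺ʳ (vars φ))

  residual-positive : ∀ φ b → Positive (residual φ b)
  residual-positive (lit i p) b with b i
  ... | just x = tt
  ... | nothing = ≤-refl , ≤-refl
  residual-positive (and2 φ ψ) b = andʳ-positive _ _ (residual-positive φ b) (residual-positive ψ b)
  residual-positive (or2 φ ψ) b rewrite orʳ-deMorgan (residual φ b) (residual ψ b) =
    negʳ-positive _ (andʳ-positive _ _ (negʳ-positive _ (residual-positive φ b))
                                       (negʳ-positive _ (residual-positive ψ b)))

  residual-unassigned : ∀ φ → residual φ unassigned ≡ sized (length (dnf φ)) (length (cnf φ))
  residual-unassigned (lit i p) = refl
  residual-unassigned (and2 φ ψ)
    rewrite residual-unassigned φ | residual-unassigned ψ
          | length-cartesianProductWith _++_ (dnf φ) (dnf ψ) | length-++ (cnf φ) {cnf ψ} = refl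
  residual-unassigned (or2 φ ψ)
    rewrite residual-unassigned φ | residual-unassigned ψ
          | length-cartesianProductWith _++_ (cnf φ) (cnf ψ) | length-++ (dnf φ) {dnf ψ} = refl

andʳ-const⁻ : ∀ x y {w} → andʳ x y ≡ const w →
              (x ≡ const false × w ≡ false) ⊎ (y ≡ const false × w ≡ false) ⊎ (x ≡ const true × y ≡ const w)
andʳ-const⁻ (const false) y refl = inj₁ (refl , refl)
andʳ-const⁻ (const true) y eq = inj₂ (inj₂ (refl , eq))
andʳ-const⁻ (sized d c) (const false) refl = inj₂ (inj₁ (refl , refl))

orʳ-const⁻ : ∀ x y {w} → orʳ x y ≡ const w →
             (x ≡ const true × w ≡ true) ⊎ (y ≡ const true × w ≡ true) ⊎ (x ≡ const false × y ≡ const w)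
orʳ-const⁻ (const true) y refl = inj₁ (refl , refl)
orʳ-const⁻ (const false) y eq = inj₂ (inj₂ (refl , eq))
orʳ-const⁻ (sized d c) (const true) refl = inj₂ (inj₁ (refl , refl))

const-injective : ∀ {x y} → const x ≡ const y → x ≡ y
const-injective refl = refl

const-≢not : ∀ {x v} → const x ≢ const (not v) → x ≡ v
const-≢not {x} {v} ne = trans (¬-not (ne ∘ cong const)) (not-involutive v)

andʳ-falseˡ : ∀ {x y} → x ≡ const false → andʳ x y ≡ const false
andʳ-falseˡ refl = refl

andʳ-falseʳ : ∀ x {y} → y ≡ const false → andʳ x y ≡ const false
andʳ-falseʳ (const true) refl = refl
andʳ-falseʳ (const false) refl = refl
andʳ-falseʳ (sized d c) refl = refl

andʳ-trueˡ : ∀ {x y} → x ≡ const true → andʳ x y ≡ y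
andʳ-trueˡ refl = refl

orʳ-trueˡ : ∀ {x y} → x ≡ const true → orʳ x y ≡ const true
orʳ-trueˡ refl = refl

orʳ-trueʳ : ∀ x {y} → y ≡ const true → orʳ x y ≡ const true
orʳ-trueʳ (const true) refl = refl
orʳ-trueʳ (const false) refl = refl
orʳ-trueʳ (sized d c) refl = refl

orʳ-falseˡ : ∀ {x y} → x ≡ const false → orʳ x y ≡ y
orʳ-falseˡ refl = refl

forcing : Bool → Bool → Bool
forcing p v = if p then v else not v

litVal-forcing : ∀ p v → litVal p (forcing p v) ≡ v
litVal-forcing true v = refl
litVal-forcing false true = refl
litVal-forcing false false = refl

module _ {n : ℕ} where

  residual-const⇒forced : ∀ φ {b : Partial n} {w} → residual φ b ≡ const w →
                          ∀ a → total a ⪰ b → eval φ a ≡ w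
  residual-const⇒forced (lit i p) {b} eq a a⪰b with b i in bi
  ... | just x rewrite Maybe.just-injective (a⪰b i x bi) = const-injective eq
  residual-const⇒forced (and2 φ ψ) {b} eq a a⪰b with andʳ-const⁻ (residual φ b) (residual ψ b) eq
  ... | inj₁ (φ≡f , refl) rewrite residual-const⇒forced φ φ≡f a a⪰b = refl
  ... | inj₂ (inj₁ (ψ≡f , refl)) rewrite residual-const⇒forced ψ ψ≡f a a⪰b = ∧-zeroʳ (eval φ a)
  ... | inj₂ (inj₂ (φ≡t , ψ≡w)) rewrite residual-const⇒forced φ φ≡t a a⪰b =
    residual-const⇒forced ψ ψ≡w a a⪰b
  residual-const⇒forced (or2 φ ψ) {b} eq a a⪰b with orʳ-const⁻ (residual φ b) (residual ψ b) eq
  ... | inj₁ (φ≡t , refl) rewrite residual-const⇒forced φ φ≡t a a⪰b = refl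
  ... | inj₂ (inj₁ (ψ≡t , refl)) rewrite residual-const⇒forced ψ ψ≡t a a⪰b = ∨-zeroʳ (eval φ a)
  ... | inj₂ (inj₂ (φ≡f , ψ≡w)) rewrite residual-const⇒forced φ φ≡f a a⪰b =
    residual-const⇒forced ψ ψ≡w a a⪰b

  open DecMembership {A = Fin n} _≟_ using () renaming (_∈?_ to _∈ᶠ?_)

  Unique-++⁻ : ∀ (xs : List (Fin n)) {ys} → Unique (xs ++ ys) → Unique xs × Unique ys × Disjoint xs ys
  Unique-++⁻ [] u = [] , u , λ ()
  Unique-++⁻ (x ∷ xs) (x∉ ∷ u) with Unique-++⁻ xs u
  ... | uxs , uys , disjoint = All.++⁻ˡ xs x∉ ∷ uxs , uys , λ where
    (here refl , x∈ys) → All.lookup (All.++⁻ʳ xs x∉) x∈ys refl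
    (there v∈xs , v∈ys) → disjoint (v∈xs , v∈ys)

  completion : Partial n → Assignment n
  completion b j = Maybe.fromMaybe false (b j)

  completion-⪰ : ∀ b → total (completion b) ⪰ b
  completion-⪰ b j ℓ eq rewrite eq = refl

  eval-local : ∀ φ (a a' : Assignment n) → (∀ j → j ∈ vars φ → a j ≡ a' j) → eval φ a ≡ eval φ a'
  eval-local (lit i p) a a' agree = cong (litVal p) (agree i (here refl))
  eval-local (and2 φ ψ) a a' agree = cong₂ _∧_ (eval-local φ a a' λ j → agree j ∘ ∈-++⁺ˡ)
                                               (eval-local ψ a a' λ j → agree j ∘ ∈-++⁺ʳ (vars φ))
  eval-local (or2 φ ψ) a a' agree = cong₂ _∨_ (eval-local φ a a' λ j → agree j ∘ ∈-++⁺ˡ)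
                                              (eval-local ψ a a' λ j → agree j ∘ ∈-++⁺ʳ (vars φ))

  Realisable : Formula n → Partial n → Bool → Set
  Realisable φ b v = ∃ λ a → total a ⪰ b × eval φ a ≡ v

  realisable-both : ∀ φ ψ {b v w} → Disjoint (vars φ) (vars ψ) → Realisable φ b v → Realisable ψ b w →
                    ∃ λ a → total a ⪰ b × eval φ a ≡ v × eval ψ a ≡ w
  realisable-both φ ψ disjoint (a₁ , a₁⪰b , e₁) (a₂ , a₂⪰b , e₂) =
    merged , merged-⪰ ,
    trans (eval-local φ merged a₁ λ j j∈φ → fromφ j∈φ) e₁ ,
    trans (eval-local ψ merged a₂ λ j j∈ψ → fromψ λ j∈φ → disjoint (j∈φ , j∈ψ)) e₂
    where
    merged : Assignment n
    merged j = if isYes (j ∈ᶠ? vars φ) then a₁ j else a₂ j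
    merged-⪰ : total merged ⪰ _
    merged-⪰ j ℓ eq with j ∈ᶠ? vars φ
    ... | yes _ = a₁⪰b j ℓ eq
    ... | no _ = a₂⪰b j ℓ eq
    fromφ : ∀ {j} → j ∈ vars φ → merged j ≡ a₁ j
    fromφ {j} j∈φ with j ∈ᶠ? vars φ
    ... | yes _ = refl
    ... | no j∉φ = contradiction j∈φ j∉φ
    fromψ : ∀ {j} → ¬ j ∈ vars φ → merged j ≡ a₂ j
    fromψ {j} j∉φ with j ∈ᶠ? vars φ
    ... | yes j∈φ = contradiction j∈φ j∉φ
    ... | no _ = refl

  realisable : ∀ φ → IsReadOnce φ → ∀ b v → residual φ b ≢ const (not v) → Realisable φ b v
  realisable (lit i p) ro b v ≢¬v with b i in bi
  ... | just x = completion b , completion-⪰ b ,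
                 trans (cong (litVal p ∘ Maybe.fromMaybe false) bi) (const-≢not ≢¬v)
  ... | nothing = completion b' , ⪰-trans (completion-⪰ b') (set-⪰ b i (forcing p v) bi) ,
                  trans (cong (litVal p ∘ Maybe.fromMaybe false) (set-same b i (forcing p v)))
                        (litVal-forcing p v)
    where b' = set b i (forcing p v)
  realisable (and2 φ ψ) ro b true ≢f with Unique-++⁻ (vars φ) ro
  ... | roφ , roψ , disjoint
    with realisable-both φ ψ disjoint (realisable φ roφ b true (≢f ∘ andʳ-falseˡ))
                                      (realisable ψ roψ b true (≢f ∘ andʳ-falseʳ (residual φ b)))
  ... | a , a⪰b , e₁ , e₂ = a , a⪰b , cong₂ _∧_ e₁ e₂
  realisable (and2 φ ψ) ro b false ≢t with Unique-++⁻ (vars φ) ro | const? (residual φ b) true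
  ... | roφ , roψ , _ | no φ≢t with realisable φ roφ b false φ≢t
  ...   | a , a⪰b , e = a , a⪰b , cong (_∧ eval ψ a) e
  realisable (and2 φ ψ) ro b false ≢t | roφ , roψ , _ | yes φ≡t
    with realisable ψ roψ b false (≢t ∘ trans (andʳ-trueˡ φ≡t))
  ...   | a , a⪰b , e = a , a⪰b , trans (cong (eval φ a ∧_) e) (∧-zeroʳ (eval φ a))
  realisable (or2 φ ψ) ro b false ≢t with Unique-++⁻ (vars φ) ro
  ... | roφ , roψ , disjoint
    with realisable-both φ ψ disjoint (realisable φ roφ b false (≢t ∘ orʳ-trueˡ))
                                      (realisable ψ roψ b false (≢t ∘ orʳ-trueʳ (residual φ b)))
  ... | a , a⪰b , e₁ , e₂ = a , a⪰b , cong₂ _∨_ e₁ e₂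
  realisable (or2 φ ψ) ro b true ≢f with Unique-++⁻ (vars φ) ro | const? (residual φ b) false
  ... | roφ , roψ , _ | no φ≢f with realisable φ roφ b true φ≢f
  ...   | a , a⪰b , e = a , a⪰b , cong (_∨ eval ψ a) e
  realisable (or2 φ ψ) ro b true ≢f | roφ , roψ , _ | yes φ≡f
    with realisable ψ roψ b true (≢f ∘ trans (orʳ-falseˡ φ≡f))
  ...   | a , a⪰b , e = a , a⪰b , trans (cong (eval φ a ∨_) e) (∨-zeroʳ (eval φ a))
module _ {n : ℕ} where

  Dom⊆ : Partial n → List (Fin n) → Set
  Dom⊆ L X = ∀ i w → L i ≡ just w → i ∈ X

  FreeIn : Partial n → Partial n → Set
  FreeIn L b = ∀ i w → L i ≡ just w → b i ≡ nothing

  Disjointᵖ : Partial n → Partial n → Set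
  Disjointᵖ L R = ∀ i v w → L i ≡ just v → R i ≡ just w → ⊥

  -- A v-split of b: disjoint fresh extensions L, R (on variables in X) that jointly force F to
  -- v, such that keptSize does not drop in either piece and sharedSize is shared out between
  -- them. Submodularity turns this into g (L ∪ R ∪ b) + g b ≤ g (L ∪ b) + g (R ∪ b).
  record Split (F : Partial n → Residual) (X : List (Fin n)) (b : Partial n) (v : Bool) : Set where
    field
      L R : Partial n
      L⊆X : Dom⊆ L X
      R⊆X : Dom⊆ R X
      L-fresh : FreeIn L b
      R-fresh : FreeIn R b
      L#R : Disjointᵖ L R
      forces : F (L ∪ (R ∪ b)) ≡ const v
      keptL : keptSize v (F b) ≤ keptSize v (F (L ∪ b))
      keptR : keptSize v (F b) ≤ keptSize v (F (R ∪ b))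
      shared : sharedSize v (F b) ≤ sharedSize v (F (L ∪ b)) + sharedSize v (F (R ∪ b))

  Proper : ∀ {F X b v} → Split F X b v → Set
  Proper {F} {X} {b} {v} s = F (Split.L s ∪ b) ≢ const v × F (Split.R s ∪ b) ≢ const v

  ProperSplit : (Partial n → Residual) → List (Fin n) → Partial n → Bool → Set
  ProperSplit F X b v = Σ (Split F X b v) Proper

  Atomic : (Partial n → Residual) → List (Fin n) → Partial n → Set
  Atomic F X b = F b ≡ sized 1 1 × Σ (Fin n) λ i → i ∈ X × b i ≡ nothing ×
                 Σ Bool λ ℓ → Σ Bool λ w → F (set b i ℓ) ≡ const w

  depends-pointwise : ∀ {F : Partial n → Residual} {X} → DependsOn F X →
                      ∀ b b' → (∀ i → b i ≡ b' i) → F b ≡ F b'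
  depends-pointwise dep b b' h = dep b b' (λ i _ → h i)

  ∪-swap : ∀ (L R b : Partial n) → Disjointᵖ L R → ∀ i → (R ∪ (L ∪ b)) i ≡ (L ∪ (R ∪ b)) i
  ∪-swap L R b L#R i with L i in eq₁ | R i in eq₂
  ... | just v | just w = ⊥-elim (L#R i v w eq₁ eq₂)
  ... | just v | nothing = refl
  ... | nothing | just w = refl
  ... | nothing | nothing = refl

  Split-swap : ∀ {F X b v} → DependsOn F X → Split F X b v → Split F X b v
  Split-swap {F} {X} {b} {v} dep s = record
    { L = R ; R = L ; L⊆X = R⊆X ; R⊆X = L⊆X ; L-fresh = R-fresh ; R-fresh = L-fresh
    ; L#R = λ i x y eq₁ eq₂ → L#R i y x eq₂ eq₁
    ; forces = trans (depends-pointwise dep _ _ (∪-swap L R b L#R)) forces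
    ; keptL = keptR ; keptR = keptL
    ; shared = subst (sharedSize v (F b) ≤_) (+-comm (sharedSize v (F (L ∪ b))) _) shared }
    where open Split s

  Split-const : ∀ {F X b v} → F b ≡ const v → Split F X b v
  Split-const {F} {X} {b} {v} eq = record
    { L = unassigned ; R = unassigned ; L⊆X = λ i w () ; R⊆X = λ i w () ; L-fresh = λ i w () ; R-fresh = λ i w ()
    ; L#R = λ i v w () ; forces = eq ; keptL = ≤-refl ; keptR = ≤-refl
    ; shared = subst (λ z → sharedSize v z ≤ sharedSize v z + sharedSize v z) (sym eq) (nothing-shared v) }
    where
    nothing-shared : ∀ v → sharedSize v (const v) ≤ sharedSize v (const v) + sharedSize v (const v)
    nothing-shared true = z≤n
    nothing-shared false = z≤n

  Split-neg : ∀ {F X b v} → Split F X b v → Split (negʳ ∘ F) X b (not v)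
  Split-neg {F} {X} {b} {v} s = record
    { L = L ; R = R ; L⊆X = L⊆X ; R⊆X = R⊆X ; L-fresh = L-fresh ; R-fresh = R-fresh ; L#R = L#R
    ; forces = negʳ-const _ v forces
    ; keptL = subst₂ _≤_ (sym (keptSize-negʳ v (F b))) (sym (keptSize-negʳ v (F (L ∪ b)))) keptL
    ; keptR = subst₂ _≤_ (sym (keptSize-negʳ v (F b))) (sym (keptSize-negʳ v (F (R ∪ b)))) keptR
    ; shared = subst₂ _≤_ (sym (sharedSize-negʳ v (F b)))
                 (sym (cong₂ _+_ (sharedSize-negʳ v (F (L ∪ b))) (sharedSize-negʳ v (F (R ∪ b))))) shared }
    where open Split s

  Proper-neg : ∀ {F X b v} (s : Split F X b v) → Proper s → Proper (Split-neg s)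
  Proper-neg {F} {X} {b} {v} s (a , c) =
    (λ e → a (negʳ-const⁻ _ v e)) , (λ e → c (negʳ-const⁻ _ v e))

  Split-retarget : ∀ {F F' X X' b v} (s : Split F X b v) → X ⊆ X' → let open Split s in
                   F b ≡ F' b → F (L ∪ b) ≡ F' (L ∪ b) → F (R ∪ b) ≡ F' (R ∪ b) →
                   F (L ∪ (R ∪ b)) ≡ F' (L ∪ (R ∪ b)) → Split F' X' b v
  Split-retarget {v = v} s sub eb eL eR eLR = record
    { L = L ; R = R ; L⊆X = λ i w q → sub (L⊆X i w q) ; R⊆X = λ i w q → sub (R⊆X i w q)
    ; L-fresh = L-fresh ; R-fresh = R-fresh ; L#R = L#R
    ; forces = trans (sym eLR) forces
    ; keptL = subst₂ (λ x y → keptSize v x ≤ keptSize v y) eb eL keptL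
    ; keptR = subst₂ (λ x y → keptSize v x ≤ keptSize v y) eb eR keptR
    ; shared = subst₂ (λ x y → sharedSize v x ≤ y) eb (cong₂ (λ x y → sharedSize v x + sharedSize v y) eL eR) shared }
    where open Split s

  ProperSplit-retarget : ∀ {F F' X X' b v} (s : Split F X b v) → Proper s → X ⊆ X' → let open Split s in
                         F b ≡ F' b → F (L ∪ b) ≡ F' (L ∪ b) → F (R ∪ b) ≡ F' (R ∪ b) →
                         F (L ∪ (R ∪ b)) ≡ F' (L ∪ (R ∪ b)) → ProperSplit F' X' b v
  ProperSplit-retarget s (¬L , ¬R) sub eb eL eR eLR =
    Split-retarget s sub eb eL eR eLR , ¬L ∘ trans eL , ¬R ∘ trans eR

  Split-transport : ∀ {F F' X X' b v} → (∀ b → F b ≡ F' b) → X ⊆ X' → Split F X b v → Split F' X' b v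
  Split-transport e sub s = Split-retarget s sub (e _) (e _) (e _) (e _)

  ProperSplit-transport : ∀ {F F' X X' b v} → (∀ b → F b ≡ F' b) → X ⊆ X' →
                          ProperSplit F X b v → ProperSplit F' X' b v
  ProperSplit-transport e sub (s , proper) = ProperSplit-retarget s proper sub (e _) (e _) (e _) (e _)

  Atomic-transport : ∀ {F F' X X' b} → (∀ b → F b ≡ F' b) → X ⊆ X' →
              Atomic F X b → Atomic F' X' b
  Atomic-transport e sub (eq , i , m , fr , ℓ , w , q) =
    trans (sym (e _)) eq , i , sub m , fr , ℓ , w , trans (sym (e _)) q

  Atomic-neg : ∀ {F X b} → Atomic F X b → Atomic (negʳ ∘ F) X b
  Atomic-neg (eq , i , m , fr , ℓ , w , q) = negʳ-sized eq , i , m , fr , ℓ , not w , negʳ-const _ w q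

  outside : ∀ {L : Partial n} {X Y} → Dom⊆ L Y → Disjoint X Y → ∀ i → i ∈ X → L i ≡ nothing
  outside {L} dom disjoint i m with L i in e
  ... | just w = contradiction (m , dom i w e) disjoint
  ... | nothing = refl

  ∪-skip : ∀ (L b : Partial n) i → L i ≡ nothing → (L ∪ b) i ≡ b i
  ∪-skip L b i e rewrite e = refl

  ∪-skipL : ∀ (L₁ L₂ b : Partial n) i → L₂ i ≡ nothing → ((L₁ ∪ L₂) ∪ b) i ≡ (L₁ ∪ b) i
  ∪-skipL L₁ L₂ b i e with L₁ i
  ... | just v = refl
  ... | nothing rewrite e = refl

  ∪-skipR : ∀ (L₁ L₂ b : Partial n) i → L₁ i ≡ nothing → ((L₁ ∪ L₂) ∪ b) i ≡ (L₂ ∪ b) i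
  ∪-skipR L₁ L₂ b i e rewrite e = refl

  module TrueConjunct (F₁ F₂ : Partial n → Residual) (X₁ X₂ : List (Fin n))
                  (dep₁ : DependsOn F₁ X₁) (disjoint : Disjoint X₁ X₂) where

    F : Partial n → Residual
    F b = andʳ (F₁ b) (F₂ b)


    F₁-skip : ∀ b (L : Partial n) → Dom⊆ L X₂ → F₁ (L ∪ b) ≡ F₁ b
    F₁-skip b L dom = dep₁ _ _ (λ i m → ∪-skip L b i (outside dom disjoint i m))

    F₁-skip-both : ∀ b (L R : Partial n) → Dom⊆ L X₂ → Dom⊆ R X₂ → F₁ (L ∪ (R ∪ b)) ≡ F₁ b
    F₁-skip-both b L R L⊆X₂ R⊆X₂ = trans (F₁-skip (R ∪ b) L L⊆X₂) (F₁-skip b R R⊆X₂)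

    F₂≡F : ∀ {b'} → F₁ b' ≡ const true → F₂ b' ≡ F b'
    F₂≡F eq rewrite eq = refl

    Split-lift : ∀ {b v} → F₁ b ≡ const true → Split F₂ X₂ b v → Split F (X₁ ++ X₂) b v
    Split-lift {b} e s = Split-retarget s (∈-++⁺ʳ X₁) (F₂≡F e) (F₂≡F (trans (F₁-skip b L L⊆X) e))
                           (F₂≡F (trans (F₁-skip b R R⊆X) e)) (F₂≡F (trans (F₁-skip-both b L R L⊆X R⊆X) e))
      where open Split s

    ProperSplit-lift : ∀ {b v} → F₁ b ≡ const true → ProperSplit F₂ X₂ b v → ProperSplit F (X₁ ++ X₂) b v
    ProperSplit-lift {b} e (s , proper) =
      ProperSplit-retarget s proper (∈-++⁺ʳ X₁) (F₂≡F e) (F₂≡F (trans (F₁-skip b L L⊆X) e))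
        (F₂≡F (trans (F₁-skip b R R⊆X) e)) (F₂≡F (trans (F₁-skip-both b L R L⊆X R⊆X) e))
      where open Split s

    Atomic-lift : ∀ {b} → F₁ b ≡ const true → Atomic F₂ X₂ b → Atomic F (X₁ ++ X₂) b
    Atomic-lift {b} e (eq , i , m , fr , ℓ , w , q) =
      trans (sym (F₂≡F e)) eq , i , ∈-++⁺ʳ X₁ m , fr , ℓ , w ,
      trans (sym (F₂≡F (trans (dep₁ _ _ λ j j∈X₁ → set-other b i ℓ λ j≡i → disjoint (subst (_∈ X₁) j≡i j∈X₁ , m)) e))) q

module _ {n : ℕ} where

  -- The invariant carried through the formula: a conjunction reaches v = true by combining
  -- true-splits of its conjuncts, and inherits a proper false-split from either conjunct.
  Splittable : (Partial n → Residual) → List (Fin n) → Partial n → Set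
  Splittable F X b = ∀ v → F b ≢ const (not v) → Split F X b v ⊎ ProperSplit F X b (not v)

  ProperlySplittable : (Partial n → Residual) → List (Fin n) → Partial n → Set
  ProperlySplittable F X b =
    F b ≢ const true → F b ≢ const false → ProperSplit F X b true ⊎ (ProperSplit F X b false ⊎ Atomic F X b)

  AllPositive : (Partial n → Residual) → Set
  AllPositive F = ∀ b → Positive (F b)

  ≢false-kept : ∀ {x y} → Positive x → x ≢ const false → dnfSize x ≤ dnfSize y → y ≢ const false
  ≢false-kept {x} {y} px x≢f x≤y = dnfSize-positive⁻ y (≤-trans (dnfSize-positive x px x≢f) x≤y)

  -- Some piece of a true-split does not force true on its own, since cnfSize (G b) ≥ 1.
  Split-orient : ∀ {G : Partial n → Residual} {X b} → DependsOn G X → AllPositive G → G b ≢ const true →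
                 Split G X b true → Σ (Split G X b true) λ s → G (Split.R s ∪ b) ≢ const true
  Split-orient {G} {X} {b} dep pos ≢t s with const? (G (R ∪ b)) true | const? (G (L ∪ b)) true
    where open Split s
  ... | no R≢t | _ = s , R≢t
  ... | yes _ | no L≢t = Split-swap dep s , L≢t
  ... | yes R≡t | yes L≡t with ≤-trans (cnfSize-positive _ (pos b) ≢t) (Split.shared s)
  ...   | 1≤0 rewrite L≡t | R≡t = contradiction 1≤0 λ ()

  module Conjunction (F₁ F₂ : Partial n → Residual) (X₁ X₂ : List (Fin n))
                     (dep₁ : DependsOn F₁ X₁) (dep₂ : DependsOn F₂ X₂) (disjoint : Disjoint X₁ X₂)
                     (pos₁ : AllPositive F₁) (pos₂ : AllPositive F₂) where

    F : Partial n → Residual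
    F b = andʳ (F₁ b) (F₂ b)

    disjoint′ : Disjoint X₂ X₁
    disjoint′ (i∈X₂ , i∈X₁) = disjoint (i∈X₁ , i∈X₂)

    F₁-ignores₂ : ∀ (S₁ S₂ c : Partial n) → Dom⊆ S₂ X₂ → F₁ ((S₁ ∪ S₂) ∪ c) ≡ F₁ (S₁ ∪ c)
    F₁-ignores₂ S₁ S₂ c S₂⊆X₂ = dep₁ _ _ λ i i∈X₁ → ∪-skipL S₁ S₂ c i (outside S₂⊆X₂ disjoint i i∈X₁)

    F₂-ignores₁ : ∀ (S₁ S₂ c : Partial n) → Dom⊆ S₁ X₁ → F₂ ((S₁ ∪ S₂) ∪ c) ≡ F₂ (S₂ ∪ c)
    F₂-ignores₁ S₁ S₂ c S₁⊆X₁ = dep₂ _ _ λ i i∈X₂ → ∪-skipR S₁ S₂ c i (outside S₁⊆X₁ disjoint′ i i∈X₂)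

    F₁-ignores₂-inner : ∀ (A S₁ S₂ c : Partial n) → Dom⊆ S₂ X₂ → F₁ (A ∪ ((S₁ ∪ S₂) ∪ c)) ≡ F₁ (A ∪ (S₁ ∪ c))
    F₁-ignores₂-inner A S₁ S₂ c S₂⊆X₂ =
      dep₁ _ _ λ i i∈X₁ → cong (A i <∣>_) (∪-skipL S₁ S₂ c i (outside S₂⊆X₂ disjoint i i∈X₁))

    F₂-ignores₁-inner : ∀ (A S₁ S₂ c : Partial n) → Dom⊆ S₁ X₁ → F₂ (A ∪ ((S₁ ∪ S₂) ∪ c)) ≡ F₂ (A ∪ (S₂ ∪ c))
    F₂-ignores₁-inner A S₁ S₂ c S₁⊆X₁ =
      dep₂ _ _ λ i i∈X₂ → cong (A i <∣>_) (∪-skipR S₁ S₂ c i (outside S₁⊆X₁ disjoint′ i i∈X₂))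

    F-∪ : ∀ {S₁ S₂} c → Dom⊆ S₁ X₁ → Dom⊆ S₂ X₂ → F ((S₁ ∪ S₂) ∪ c) ≡ andʳ (F₁ (S₁ ∪ c)) (F₂ (S₂ ∪ c))
    F-∪ {S₁} {S₂} c S₁⊆X₁ S₂⊆X₂ = cong₂ andʳ (F₁-ignores₂ S₁ S₂ c S₂⊆X₂) (F₂-ignores₁ S₁ S₂ c S₁⊆X₁)

    Dom⊆-∪ : ∀ {S₁ S₂ : Partial n} → Dom⊆ S₁ X₁ → Dom⊆ S₂ X₂ → Dom⊆ (S₁ ∪ S₂) (X₁ ++ X₂)
    Dom⊆-∪ {S₁} S₁⊆X₁ S₂⊆X₂ i w eq with S₁ i in S₁i
    ... | just v = ∈-++⁺ˡ (S₁⊆X₁ i v S₁i)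
    ... | nothing = ∈-++⁺ʳ X₁ (S₂⊆X₂ i w eq)

    FreeIn-∪ : ∀ {S₁ S₂ b : Partial n} → FreeIn S₁ b → FreeIn S₂ b → FreeIn (S₁ ∪ S₂) b
    FreeIn-∪ {S₁} fresh₁ fresh₂ i w eq with S₁ i in S₁i
    ... | just v = fresh₁ i v S₁i
    ... | nothing = fresh₂ i w eq

    Disjointᵖ-∪ : ∀ {L₁ L₂ R₁ R₂ : Partial n} → Dom⊆ L₁ X₁ → Dom⊆ L₂ X₂ → Dom⊆ R₁ X₁ → Dom⊆ R₂ X₂ →
                  Disjointᵖ L₁ R₁ → Disjointᵖ L₂ R₂ → Disjointᵖ (L₁ ∪ L₂) (R₁ ∪ R₂)
    Disjointᵖ-∪ {L₁} {L₂} {R₁} {R₂} L₁⊆ L₂⊆ R₁⊆ R₂⊆ L#R₁ L#R₂ i v w eqL eqR with L₁ i in L₁i | R₁ i in R₁i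
    ... | just a | just c = L#R₁ i a c L₁i R₁i
    ... | just a | nothing = disjoint (L₁⊆ i a L₁i , R₂⊆ i w eqR)
    ... | nothing | just c = disjoint (R₁⊆ i c R₁i , L₂⊆ i v eqL)
    ... | nothing | nothing = L#R₂ i v w eqL eqR

    -- DNF sizes multiply and CNF sizes add, so true-splits of both conjuncts combine piecewise.
    Split-∧ : ∀ {b} → Split F₁ X₁ b true → Split F₂ X₂ b true → F₁ b ≢ const false → F₂ b ≢ const false →
              Split F (X₁ ++ X₂) b true
    Split-∧ {b} s₁ s₂ ≢f₁ ≢f₂ = record
      { L = L₁ ∪ L₂ ; R = R₁ ∪ R₂
      ; L⊆X = Dom⊆-∪ L₁⊆ L₂⊆ ; R⊆X = Dom⊆-∪ R₁⊆ R₂⊆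
      ; L-fresh = FreeIn-∪ L₁-fresh L₂-fresh ; R-fresh = FreeIn-∪ R₁-fresh R₂-fresh
      ; L#R = Disjointᵖ-∪ L₁⊆ L₂⊆ R₁⊆ R₂⊆ L#R₁ L#R₂
      ; forces = cong₂ andʳ (trans (F₁-ignores₂ L₁ L₂ _ L₂⊆) (trans (F₁-ignores₂-inner L₁ R₁ R₂ b R₂⊆) forces₁))
                            (trans (F₂-ignores₁ L₁ L₂ _ L₁⊆) (trans (F₂-ignores₁-inner L₂ R₁ R₂ b R₁⊆) forces₂))
      ; keptL = subst (λ x → dnfSize (F b) ≤ dnfSize x) (sym (F-∪ b L₁⊆ L₂⊆))
                  (dnfSize-andʳ-mono _ _ _ _ ≢f₁ ≢f₂ (≢f-kept pos₁ ≢f₁ keptL₁) (≢f-kept pos₂ ≢f₂ keptL₂) keptL₁ keptL₂)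
      ; keptR = subst (λ x → dnfSize (F b) ≤ dnfSize x) (sym (F-∪ b R₁⊆ R₂⊆))
                  (dnfSize-andʳ-mono _ _ _ _ ≢f₁ ≢f₂ (≢f-kept pos₁ ≢f₁ keptR₁) (≢f-kept pos₂ ≢f₂ keptR₂) keptR₁ keptR₂)
      ; shared = subst₂ (λ x y → cnfSize (F b) ≤ cnfSize x + cnfSize y) (sym (F-∪ b L₁⊆ L₂⊆)) (sym (F-∪ b R₁⊆ R₂⊆))
                   (cnfSize-andʳ-split _ _ _ _ _ _ ≢f₁ ≢f₂
                     (≢f-kept pos₁ ≢f₁ keptL₁) (≢f-kept pos₂ ≢f₂ keptL₂)
                     (≢f-kept pos₁ ≢f₁ keptR₁) (≢f-kept pos₂ ≢f₂ keptR₂) shared₁ shared₂) }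
      where
      open Split s₁ renaming (L to L₁; R to R₁; L⊆X to L₁⊆; R⊆X to R₁⊆; L-fresh to L₁-fresh; R-fresh to R₁-fresh;
                              L#R to L#R₁; forces to forces₁; keptL to keptL₁; keptR to keptR₁; shared to shared₁)
      open Split s₂ renaming (L to L₂; R to R₂; L⊆X to L₂⊆; R⊆X to R₂⊆; L-fresh to L₂-fresh; R-fresh to R₂-fresh;
                              L#R to L#R₂; forces to forces₂; keptL to keptL₂; keptR to keptR₂; shared to shared₂)
      ≢f-kept : ∀ {G : Partial n → Residual} {b'} → AllPositive G → G b ≢ const false →
                dnfSize (G b) ≤ dnfSize (G b') → G b' ≢ const false
      ≢f-kept pos = ≢false-kept (pos b)

    -- Pair the piece of s₁ that does not force true with the piece of s₂ that does, and vice versa.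
    ProperSplit-∧ : ∀ {b} → Split F₁ X₁ b true → Split F₂ X₂ b true →
                    F₁ b ≢ const false → F₂ b ≢ const false → F₁ b ≢ const true → F₂ b ≢ const true →
                    ProperSplit F (X₁ ++ X₂) b true
    ProperSplit-∧ {b} s₁ s₂ ≢f₁ ≢f₂ ≢t₁ ≢t₂ with Split-orient dep₁ pos₁ ≢t₁ s₁ | Split-orient dep₂ pos₂ ≢t₂ s₂
    ... | s₁′ , R₁≢t | s₂′ , R₂≢t =
      Split-∧ s₁′ s₂″ ≢f₁ ≢f₂ ,
      (λ eq → R₂≢t (proj₂ (andʳ-true⁻ _ _ (trans (sym (F-∪ b L₁⊆ L₂⊆)) eq)))) ,
      (λ eq → R₁≢t (proj₁ (andʳ-true⁻ _ _ (trans (sym (F-∪ b R₁⊆ R₂⊆)) eq))))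
      where
      s₂″ = Split-swap dep₂ s₂′
      open Split s₁′ renaming (L⊆X to L₁⊆; R⊆X to R₁⊆)
      open Split s₂″ renaming (L⊆X to L₂⊆; R⊆X to R₂⊆)

    ProperSplit-∧-false : ∀ {b} → ProperSplit F₁ X₁ b false → F₁ b ≢ const false → F₂ b ≢ const false →
                          ProperSplit F (X₁ ++ X₂) b false
    ProperSplit-∧-false {b} (s , L≢f , R≢f) ≢f₁ ≢f₂ = record
      { L = L ; R = R
      ; L⊆X = λ i w eq → ∈-++⁺ˡ (L⊆X i w eq) ; R⊆X = λ i w eq → ∈-++⁺ˡ (R⊆X i w eq)
      ; L-fresh = L-fresh ; R-fresh = R-fresh ; L#R = L#R
      ; forces = cong (λ x → andʳ x (F₂ (L ∪ (R ∪ b)))) forces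
      ; keptL = kept L L⊆X L≢f keptL
      ; keptR = kept R R⊆X R≢f keptR
      ; shared = subst₂ (λ x y → dnfSize (F b) ≤ dnfSize (andʳ (F₁ (L ∪ b)) x) + dnfSize (andʳ (F₁ (R ∪ b)) y))
                   (sym (F₂-unchanged L L⊆X)) (sym (F₂-unchanged R R⊆X))
                   (subst₂ _≤_ (sym (dnfSize-andʳ _ _ ≢f₁ ≢f₂))
                     (sym (cong₂ _+_ (dnfSize-andʳ _ _ L≢f ≢f₂) (dnfSize-andʳ _ _ R≢f ≢f₂)))
                     (subst (dnfSize (F₁ b) * dnfSize (F₂ b) ≤_)
                            (*-distribʳ-+ (dnfSize (F₂ b)) (dnfSize (F₁ (L ∪ b))) (dnfSize (F₁ (R ∪ b))))
                            (*-monoˡ-≤ (dnfSize (F₂ b)) shared))) } ,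
      andʳ-≢false _ _ L≢f (≢f₂ ∘ trans (sym (F₂-unchanged L L⊆X))) ,
      andʳ-≢false _ _ R≢f (≢f₂ ∘ trans (sym (F₂-unchanged R R⊆X)))
      where
      open Split s
      F₂-unchanged : ∀ S → Dom⊆ S X₁ → F₂ (S ∪ b) ≡ F₂ b
      F₂-unchanged S S⊆X₁ = dep₂ _ _ λ i i∈X₂ → ∪-skip S b i (outside S⊆X₁ disjoint′ i i∈X₂)
      kept : ∀ S → Dom⊆ S X₁ → F₁ (S ∪ b) ≢ const false → cnfSize (F₁ b) ≤ cnfSize (F₁ (S ∪ b)) →
             cnfSize (F b) ≤ cnfSize (F (S ∪ b))
      kept S S⊆X₁ S≢f c≤c = subst (λ x → cnfSize (F b) ≤ cnfSize (andʳ (F₁ (S ∪ b)) x)) (sym (F₂-unchanged S S⊆X₁))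
        (subst₂ _≤_ (sym (cnfSize-andʳ _ _ ≢f₁ ≢f₂)) (sym (cnfSize-andʳ _ _ S≢f ≢f₂)) (+-monoˡ-≤ _ c≤c))


module _ {n : ℕ} where

  Split-of-const : ∀ {F : Partial n → Residual} {X b w v} → F b ≡ const w → F b ≢ const (not v) → Split F X b v
  Split-of-const eq ≢¬v = Split-const (trans eq (cong const (const-≢not (≢¬v ∘ trans eq))))

  module ConjunctionSplittable (F₁ F₂ : Partial n → Residual) (X₁ X₂ : List (Fin n))
              (dep₁ : DependsOn F₁ X₁) (dep₂ : DependsOn F₂ X₂) (disjoint : Disjoint X₁ X₂)
              (pos₁ : AllPositive F₁) (pos₂ : AllPositive F₂) where

    open Conjunction F₁ F₂ X₁ X₂ dep₁ dep₂ disjoint pos₁ pos₂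
    module Flipped = Conjunction F₂ F₁ X₂ X₁ dep₂ dep₁ disjoint′ pos₂ pos₁
    module When₁True = TrueConjunct F₁ F₂ X₁ X₂ dep₁ disjoint
    module When₂True = TrueConjunct F₂ F₁ X₂ X₁ dep₂ disjoint′

    F-comm : ∀ b → Flipped.F b ≡ F b
    F-comm b = andʳ-comm (F₂ b) (F₁ b)

    vars-comm : X₂ ++ X₁ ⊆ X₁ ++ X₂
    vars-comm = Any.++-comm X₂ X₁

    F₂≡F : ∀ {b} → F₂ b ≡ const true → F₁ b ≡ F b
    F₂≡F {b} eq = trans (When₂True.F₂≡F eq) (F-comm b)

    both-nonConst : ∀ {b} → Splittable F₁ X₁ b → Splittable F₂ X₂ b →
                    F₁ b ≢ const true → F₁ b ≢ const false → F₂ b ≢ const true → F₂ b ≢ const false →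
                    (Split F (X₁ ++ X₂) b true × ProperSplit F (X₁ ++ X₂) b true) ⊎ ProperSplit F (X₁ ++ X₂) b false
    both-nonConst spl₁ spl₂ ≢t₁ ≢f₁ ≢t₂ ≢f₂ with spl₁ true ≢f₁ | spl₂ true ≢f₂
    ... | inj₁ s₁ | inj₁ s₂ = inj₁ (Split-∧ s₁ s₂ ≢f₁ ≢f₂ , ProperSplit-∧ s₁ s₂ ≢f₁ ≢f₂ ≢t₁ ≢t₂)
    ... | inj₂ ps₁ | _ = inj₂ (ProperSplit-∧-false ps₁ ≢f₁ ≢f₂)
    ... | inj₁ _ | inj₂ ps₂ =
      inj₂ (ProperSplit-transport F-comm vars-comm (Flipped.ProperSplit-∧-false ps₂ ≢f₂ ≢f₁))

    Splittable-∧ : ∀ {b} → Splittable F₁ X₁ b → Splittable F₂ X₂ b → Splittable F (X₁ ++ X₂) b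
    Splittable-∧ {b} spl₁ spl₂ v ≢¬v with shape (F₁ b) | shape (F₂ b)
    ... | isConst true t₁ | _ with spl₂ v (≢¬v ∘ trans (sym (When₁True.F₂≡F t₁)))
    ...   | inj₁ s = inj₁ (When₁True.Split-lift t₁ s)
    ...   | inj₂ ps = inj₂ (When₁True.ProperSplit-lift t₁ ps)
    Splittable-∧ {b} spl₁ spl₂ v ≢¬v | isConst false f₁ | _ = inj₁ (Split-of-const (andʳ-falseˡ f₁) ≢¬v)
    Splittable-∧ {b} spl₁ spl₂ v ≢¬v | nonConst _ _ | isConst false f₂ =
      inj₁ (Split-of-const (andʳ-falseʳ (F₁ b) f₂) ≢¬v)
    Splittable-∧ {b} spl₁ spl₂ v ≢¬v | nonConst _ _ | isConst true t₂ with spl₁ v (≢¬v ∘ trans (sym (F₂≡F t₂)))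
    ...   | inj₁ s = inj₁ (Split-transport F-comm vars-comm (When₂True.Split-lift t₂ s))
    ...   | inj₂ ps = inj₂ (ProperSplit-transport F-comm vars-comm (When₂True.ProperSplit-lift t₂ ps))
    Splittable-∧ {b} spl₁ spl₂ true ≢¬v | nonConst ≢t₁ ≢f₁ | nonConst ≢t₂ ≢f₂
      with both-nonConst spl₁ spl₂ ≢t₁ ≢f₁ ≢t₂ ≢f₂
    ...   | inj₁ (s , _) = inj₁ s
    ...   | inj₂ ps = inj₂ ps
    Splittable-∧ {b} spl₁ spl₂ false ≢¬v | nonConst ≢t₁ ≢f₁ | nonConst ≢t₂ ≢f₂
      with both-nonConst spl₁ spl₂ ≢t₁ ≢f₁ ≢t₂ ≢f₂
    ...   | inj₁ (_ , ps) = inj₂ ps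
    ...   | inj₂ (s , _) = inj₁ s

    ProperlySplittable-∧ : ∀ {b} → Splittable F₁ X₁ b → Splittable F₂ X₂ b →
                           ProperlySplittable F₁ X₁ b → ProperlySplittable F₂ X₂ b → ProperlySplittable F (X₁ ++ X₂) b
    ProperlySplittable-∧ {b} spl₁ spl₂ pspl₁ pspl₂ ≢t ≢f with shape (F₁ b) | shape (F₂ b)
    ... | isConst true t₁ | _ with pspl₂ (≢t ∘ trans (sym (When₁True.F₂≡F t₁))) (≢f ∘ trans (sym (When₁True.F₂≡F t₁)))
    ...   | inj₁ ps = inj₁ (When₁True.ProperSplit-lift t₁ ps)
    ...   | inj₂ (inj₁ ps) = inj₂ (inj₁ (When₁True.ProperSplit-lift t₁ ps))
    ...   | inj₂ (inj₂ atomic) = inj₂ (inj₂ (When₁True.Atomic-lift t₁ atomic))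
    ProperlySplittable-∧ {b} spl₁ spl₂ pspl₁ pspl₂ ≢t ≢f | isConst false f₁ | _ = contradiction (andʳ-falseˡ f₁) ≢f
    ProperlySplittable-∧ {b} spl₁ spl₂ pspl₁ pspl₂ ≢t ≢f | nonConst _ _ | isConst false f₂ =
      contradiction (andʳ-falseʳ (F₁ b) f₂) ≢f
    ProperlySplittable-∧ {b} spl₁ spl₂ pspl₁ pspl₂ ≢t ≢f | nonConst _ _ | isConst true t₂
      with pspl₁ (≢t ∘ trans (sym (F₂≡F t₂))) (≢f ∘ trans (sym (F₂≡F t₂)))
    ...   | inj₁ ps = inj₁ (ProperSplit-transport F-comm vars-comm (When₂True.ProperSplit-lift t₂ ps))
    ...   | inj₂ (inj₁ ps) = inj₂ (inj₁ (ProperSplit-transport F-comm vars-comm (When₂True.ProperSplit-lift t₂ ps)))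
    ...   | inj₂ (inj₂ atomic) = inj₂ (inj₂ (Atomic-transport F-comm vars-comm (When₂True.Atomic-lift t₂ atomic)))
    ProperlySplittable-∧ {b} spl₁ spl₂ pspl₁ pspl₂ ≢t ≢f | nonConst ≢t₁ ≢f₁ | nonConst ≢t₂ ≢f₂
      with both-nonConst spl₁ spl₂ ≢t₁ ≢f₁ ≢t₂ ≢f₂
    ...   | inj₁ (_ , ps) = inj₁ ps
    ...   | inj₂ ps = inj₂ (inj₁ ps)

  ProperSplit-neg : ∀ {F : Partial n → Residual} {X b v} → ProperSplit F X b v → ProperSplit (negʳ ∘ F) X b (not v)
  ProperSplit-neg (s , proper) = Split-neg s , Proper-neg s proper

  Splittable-neg : ∀ {F : Partial n → Residual} {X b} → Splittable F X b → Splittable (negʳ ∘ F) X b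
  Splittable-neg spl true ≢f with spl false (≢f ∘ negʳ-const _ true)
  ... | inj₁ s = inj₁ (Split-neg s)
  ... | inj₂ ps = inj₂ (ProperSplit-neg ps)
  Splittable-neg spl false ≢t with spl true (≢t ∘ negʳ-const _ false)
  ... | inj₁ s = inj₁ (Split-neg s)
  ... | inj₂ ps = inj₂ (ProperSplit-neg ps)

  ProperlySplittable-neg : ∀ {F : Partial n → Residual} {X b} →
                           ProperlySplittable F X b → ProperlySplittable (negʳ ∘ F) X b
  ProperlySplittable-neg {F} pspl ≢t ≢f with pspl (≢f ∘ negʳ-const _ true) (≢t ∘ negʳ-const _ false)
  ... | inj₁ ps = inj₂ (inj₁ (ProperSplit-neg ps))
  ... | inj₂ (inj₁ ps) = inj₁ (ProperSplit-neg ps)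
  ... | inj₂ (inj₂ atomic) = inj₂ (inj₂ (Atomic-neg {F = F} atomic))

  Splittable-transport : ∀ {F F' : Partial n → Residual} {X X' b} → (∀ b → F b ≡ F' b) → X ⊆ X' →
                         Splittable F X b → Splittable F' X' b
  Splittable-transport e sub spl v ≢¬v with spl v (≢¬v ∘ trans (sym (e _)))
  ... | inj₁ s = inj₁ (Split-transport e sub s)
  ... | inj₂ ps = inj₂ (ProperSplit-transport e sub ps)

  ProperlySplittable-transport : ∀ {F F' : Partial n → Residual} {X X' b} → (∀ b → F b ≡ F' b) → X ⊆ X' →
                                 ProperlySplittable F X b → ProperlySplittable F' X' b
  ProperlySplittable-transport e sub pspl ≢t ≢f with pspl (≢t ∘ trans (sym (e _))) (≢f ∘ trans (sym (e _)))
  ... | inj₁ ps = inj₁ (ProperSplit-transport e sub ps)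
  ... | inj₂ (inj₁ ps) = inj₂ (inj₁ (ProperSplit-transport e sub ps))
  ... | inj₂ (inj₂ atomic) = inj₂ (inj₂ (Atomic-transport e sub atomic))

  Split-lit : ∀ i p b v → b i ≡ nothing → Split (residual (lit {n} i p)) (i ∷ []) b v
  Split-lit i p b v free = record
    { L = set unassigned i (forcing p v) ; R = unassigned
    ; L⊆X = λ j w eq → here (set-unassigned-dom eq) ; R⊆X = λ j w ()
    ; L-fresh = λ j w eq → subst (λ k → b k ≡ nothing) (sym (set-unassigned-dom eq)) free
    ; R-fresh = λ j w ()
    ; L#R = λ j v w eq ()
    ; forces = forces
    ; keptL = subst₂ (λ x y → keptSize v x ≤ keptSize v y) (sym at-b) (sym forces) (kept v)
    ; keptR = ≤-refl
    ; shared = subst₂ (λ x y → sharedSize v x ≤ sharedSize v y + sharedSize v x) (sym at-b) (sym forces) (shared v) }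
    where
    at-b : litResidual p (b i) ≡ sized 1 1
    at-b = cong (litResidual p) free
    forces : litResidual p (set unassigned i (forcing p v) i <∣> b i) ≡ const v
    forces rewrite set-same unassigned i (forcing p v) = cong const (litVal-forcing p v)
    kept : ∀ v → keptSize v (sized 1 1) ≤ keptSize v (const v)
    kept true = ≤-refl
    kept false = ≤-refl
    shared : ∀ v → sharedSize v (sized 1 1) ≤ sharedSize v (const v) + sharedSize v (sized 1 1)
    shared true = ≤-refl
    shared false = ≤-refl

  Splittable-lit : ∀ i p b → Splittable (residual (lit {n} i p)) (i ∷ []) b
  Splittable-lit i p b v ≢¬v with b i in bi
  ... | just x = inj₁ (Split-const (trans (cong (litResidual p) bi) (cong const (const-≢not ≢¬v))))
  ... | nothing = inj₁ (Split-lit i p b v bi)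

  ProperlySplittable-lit : ∀ i p b → ProperlySplittable (residual (lit {n} i p)) (i ∷ []) b
  ProperlySplittable-lit i p b ≢t ≢f with b i in bi
  ... | just x = ⊥-elim (≢const ≢t ≢f (litVal p x) refl)
  ... | nothing = inj₂ (inj₂ (refl , i , here refl , bi , true , litVal p true ,
                   cong (litResidual p) (set-same b i true)))

  DependsOn-neg : ∀ {F X} → DependsOn {n} F X → DependsOn (negʳ ∘ F) X
  DependsOn-neg dep b b' h = cong negʳ (dep b b' h)

  AllPositive-neg : ∀ {F} → AllPositive {n} F → AllPositive (negʳ ∘ F)
  AllPositive-neg pos b = negʳ-positive _ (pos b)

  module Gates (φ ψ : Formula n) (disjoint : Disjoint (vars φ) (vars ψ)) where
    module ∧ = ConjunctionSplittable (residual φ) (residual ψ) (vars φ) (vars ψ)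
                 (residual-local φ) (residual-local ψ) disjoint (residual-positive φ) (residual-positive ψ)
    module ∨ = ConjunctionSplittable (negʳ ∘ residual φ) (negʳ ∘ residual ψ) (vars φ) (vars ψ)
                 (DependsOn-neg (residual-local φ)) (DependsOn-neg (residual-local ψ)) disjoint
                 (AllPositive-neg (residual-positive φ)) (AllPositive-neg (residual-positive ψ))

    deMorgan : ∀ b → negʳ (andʳ (negʳ (residual φ b)) (negʳ (residual ψ b))) ≡ residual (or2 φ ψ) b
    deMorgan b = sym (orʳ-deMorgan (residual φ b) (residual ψ b))

  splittable : ∀ (φ : Formula n) → IsReadOnce φ → ∀ b → Splittable (residual φ) (vars φ) b
  properlySplittable : ∀ (φ : Formula n) → IsReadOnce φ → ∀ b → ProperlySplittable (residual φ) (vars φ) b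
  splittable (lit i p) ro b = Splittable-lit i p b
  splittable (and2 φ ψ) ro b with Unique-++⁻ (vars φ) ro
  ... | ro₁ , ro₂ , disjoint = ∧.Splittable-∧ (splittable φ ro₁ b) (splittable ψ ro₂ b)
    where open Gates φ ψ disjoint
  splittable (or2 φ ψ) ro b with Unique-++⁻ (vars φ) ro
  ... | ro₁ , ro₂ , disjoint =
    Splittable-transport deMorgan id
      (Splittable-neg (∨.Splittable-∧ (Splittable-neg (splittable φ ro₁ b)) (Splittable-neg (splittable ψ ro₂ b))))
    where open Gates φ ψ disjoint
  properlySplittable (lit i p) ro b = ProperlySplittable-lit i p b
  properlySplittable (and2 φ ψ) ro b with Unique-++⁻ (vars φ) ro
  ... | ro₁ , ro₂ , disjoint =
    ∧.ProperlySplittable-∧ (splittable φ ro₁ b) (splittable ψ ro₂ b)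
                           (properlySplittable φ ro₁ b) (properlySplittable ψ ro₂ b)
    where open Gates φ ψ disjoint
  properlySplittable (or2 φ ψ) ro b with Unique-++⁻ (vars φ) ro
  ... | ro₁ , ro₂ , disjoint =
    ProperlySplittable-transport deMorgan id
      (ProperlySplittable-neg (∨.ProperlySplittable-∧
        (Splittable-neg (splittable φ ro₁ b)) (Splittable-neg (splittable ψ ro₂ b))
        (ProperlySplittable-neg (properlySplittable φ ro₁ b)) (ProperlySplittable-neg (properlySplittable ψ ro₂ b))))
    where open Gates φ ψ disjoint



sizeProduct-split : ∀ v x y z → keptSize v x ≤ keptSize v y → keptSize v x ≤ keptSize v z →
                    sharedSize v x ≤ sharedSize v y + sharedSize v z →
                    sizeProduct x ≤ sizeProduct y + sizeProduct z
sizeProduct-split true x y z dy dz c = begin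
  dnfSize x * cnfSize x                         ≤⟨ *-monoʳ-≤ (dnfSize x) c ⟩
  dnfSize x * (cnfSize y + cnfSize z)           ≡⟨ *-distribˡ-+ (dnfSize x) (cnfSize y) (cnfSize z) ⟩
  dnfSize x * cnfSize y + dnfSize x * cnfSize z ≤⟨ +-mono-≤ (*-monoˡ-≤ (cnfSize y) dy) (*-monoˡ-≤ (cnfSize z) dz) ⟩
  dnfSize y * cnfSize y + dnfSize z * cnfSize z ∎
  where open ≤-Reasoning
sizeProduct-split false x y z cy cz d = begin
  dnfSize x * cnfSize x                         ≤⟨ *-monoˡ-≤ (cnfSize x) d ⟩
  (dnfSize y + dnfSize z) * cnfSize x           ≡⟨ *-distribʳ-+ (cnfSize x) (dnfSize y) (dnfSize z) ⟩
  dnfSize y * cnfSize x + dnfSize z * cnfSize x ≤⟨ +-mono-≤ (*-monoʳ-≤ (dnfSize y) cy) (*-monoʳ-≤ (dnfSize z) cz) ⟩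
  dnfSize y * cnfSize y + dnfSize z * cnfSize z ∎
  where open ≤-Reasoning

+-chain-≤ : ∀ a b c d e f → a + b ≤ c + d → d + e ≤ b + f → a + e ≤ c + f
+-chain-≤ a b c d e f ab≤cd de≤bf = +-cancelˡ-≤ (b + d) (a + e) (c + f) (begin
  (b + d) + (a + e)   ≡⟨ shuffle₁ a b d e ⟩
  (a + b) + (d + e)   ≤⟨ +-mono-≤ ab≤cd de≤bf ⟩
  (c + d) + (b + f)   ≡⟨ shuffle₂ b c d f ⟩
  (b + d) + (c + f)   ∎)
  where
  open ≤-Reasoning
  shuffle₁ : ∀ a b d e → (b + d) + (a + e) ≡ (a + b) + (d + e)
  shuffle₁ = solve-∀
  shuffle₂ : ∀ b c d f → (c + d) + (b + f) ≡ (b + d) + (c + f)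
  shuffle₂ = solve-∀

module _ {n : ℕ} where

  assignAll : Partial n → List (Literal n) → Partial n
  assignAll b [] = b
  assignAll b ((i , ℓ) ∷ L) = assignAll (set b i ℓ) L

  FreshFor : Partial n → List (Literal n) → Set
  FreshFor b [] = ⊤
  FreshFor b ((i , ℓ) ∷ L) = b i ≡ nothing × FreshFor (set b i ℓ) L

  submodular-assignAll : ∀ (g : Partial n → ℕ) → Submodular g → ∀ L b b' → b' ⪰ b →
                         FreshFor b L → FreshFor b' L → g (assignAll b' L) + g b ≤ g (assignAll b L) + g b'
  submodular-assignAll g sub [] b b' b'⪰b _ _ = ≤-reflexive (+-comm (g b') (g b))
  submodular-assignAll g sub ((i , ℓ) ∷ L) b b' b'⪰b (free , fresh) (free' , fresh') =
    +-chain-≤ (g (assignAll (set b' i ℓ) L)) (g (set b i ℓ)) (g (assignAll (set b i ℓ) L)) (g (set b' i ℓ))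
              (g b) (g b')
      (submodular-assignAll g sub L (set b i ℓ) (set b' i ℓ) (set-mono i ℓ b'⪰b) fresh fresh')
      (sub b b' i ℓ b'⪰b free free')

  assignments : Partial n → List (Fin n) → List (Literal n)
  assignments S [] = []
  assignments S (i ∷ is) with S i
  ... | just ℓ = (i , ℓ) ∷ assignments S is
  ... | nothing = assignments S is

  assignAll-outside : ∀ S is b {j} → ¬ j ∈ is → assignAll b (assignments S is) j ≡ b j
  assignAll-outside S [] b j∉ = refl
  assignAll-outside S (i ∷ is) b {j} j∉ with S i
  ... | just ℓ = trans (assignAll-outside S is (set b i ℓ) (j∉ ∘ there)) (set-other b i ℓ (j∉ ∘ here))
  ... | nothing = assignAll-outside S is b (j∉ ∘ there)

  assignAll-inside : ∀ S is b {j} → Unique is → j ∈ is → assignAll b (assignments S is) j ≡ (S ∪ b) j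
  assignAll-inside S (i ∷ is) b (i∉ ∷ u) (here refl) with S i
  ... | just ℓ = trans (assignAll-outside S is (set b i ℓ) λ i∈ → All.lookup i∉ i∈ refl) (set-same b i ℓ)
  ... | nothing = assignAll-outside S is b λ i∈ → All.lookup i∉ i∈ refl
  assignAll-inside S (i ∷ is) b {j} (i∉ ∷ u) (there j∈) with S i
  ... | just ℓ = trans (assignAll-inside S is (set b i ℓ) u j∈)
                       (cong (S j <∣>_) (set-other b i ℓ λ j≡i → All.lookup i∉ j∈ (sym j≡i)))
  ... | nothing = assignAll-inside S is b u j∈

  FreshFor-assignments : ∀ S is b → Unique is → (∀ {j w} → j ∈ is → S j ≡ just w → b j ≡ nothing) →
                         FreshFor b (assignments S is)
  FreshFor-assignments S [] b u fresh = tt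
  FreshFor-assignments S (i ∷ is) b (i∉ ∷ u) fresh with S i in Si
  ... | just ℓ = fresh (here refl) Si ,
                 FreshFor-assignments S is (set b i ℓ) u λ j∈ Sj →
                   trans (set-other b i ℓ λ j≡i → All.lookup i∉ j∈ (sym j≡i)) (fresh (there j∈) Sj)
  ... | nothing = FreshFor-assignments S is b u (fresh ∘ there)

  -- S ∪ b built one variable at a time, so that submodularity applies; since a goal function
  -- need not respect pointwise equality, it is evaluated on extend b S rather than on S ∪ b.
  extend : Partial n → Partial n → Partial n
  extend b S = assignAll b (assignments S (allFin n))

  extend-pointwise : ∀ b S j → extend b S j ≡ (S ∪ b) j
  extend-pointwise b S j = assignAll-inside S (allFin n) b (allFin⁺ n) (∈-allFin j)

  submodular-extend : ∀ (g : Partial n → ℕ) → Submodular g → ∀ S {b b'} → b' ⪰ b →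
                      FreeIn S b → FreeIn S b' → g (extend b' S) + g b ≤ g (extend b S) + g b'
  submodular-extend g sub S {b} {b'} b'⪰b fresh fresh' =
    submodular-assignAll g sub (assignments S (allFin n)) b b' b'⪰b
      (FreshFor-assignments S (allFin n) b (allFin⁺ n) λ {j} {w} _ → fresh j w)
      (FreshFor-assignments S (allFin n) b' (allFin⁺ n) λ {j} {w} _ → fresh' j w)

  freeCount : Partial n → ℕ
  freeCount b = countFalse (λ i → Maybe.is-just (b i)) (allFin n)

  freeCount-extend-< : ∀ b S {j w} → FreeIn S b → S j ≡ just w → freeCount (extend b S) < freeCount b
  freeCount-extend-< b S {j} {w} fresh Sj =
    countFalse-strict (Maybe.is-just ∘ b) (Maybe.is-just ∘ extend b S) stays (∈-allFin j) unassignedAt assignedAt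
    where
    stays : ∀ i → T (Maybe.is-just (b i)) → T (Maybe.is-just (extend b S i))
    stays i t rewrite extend-pointwise b S i with S i
    ... | just _ = tt
    ... | nothing = t
    unassignedAt : ¬ T (Maybe.is-just (b j))
    unassignedAt rewrite fresh j w Sj = λ ()
    assignedAt : T (Maybe.is-just (extend b S j))
    assignedAt rewrite extend-pointwise b S j | Sj = tt

  someAssigned : ∀ (S : Partial n) → ¬ (∀ j → S j ≡ nothing) → ∃ λ j → ∃ λ w → S j ≡ just w
  someAssigned S ¬none with ¬∀⟶∃¬ n (λ j → S j ≡ nothing) (λ j → Maybe.≡-dec _≟ᵇ_ (S j) nothing) ¬none
  ... | j , Sj≢nothing with S j in Sj
  ...   | just w = j , w , Sj
  ...   | nothing = contradiction refl Sj≢nothing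

forced⇒certificate : ∀ {n} {f : BoolFun n} {b} w → (∀ a → total a ⪰ b → f a ≡ w) → IsCertificate f b
forced⇒certificate false forced = inj₁ forced
forced⇒certificate true forced = inj₂ forced

split-bound : ∀ X G Y Z GY GZ Q → X ≤ Y + Z → Q + G ≤ GY + GZ → Y + GY ≤ Q → Z + GZ ≤ Q → X + G ≤ Q
split-bound X G Y Z GY GZ Q X≤ QG≤ Y≤ Z≤ = +-cancelʳ-≤ Q (X + G) Q (begin
  (X + G) + Q           ≤⟨ +-monoˡ-≤ Q (+-monoˡ-≤ G X≤) ⟩
  ((Y + Z) + G) + Q     ≡⟨ shuffle Y Z G Q ⟩
  (Y + Z) + (Q + G)     ≤⟨ +-monoʳ-≤ (Y + Z) QG≤ ⟩
  (Y + Z) + (GY + GZ)   ≡⟨ shuffle′ Y Z GY GZ ⟩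
  (Y + GY) + (Z + GZ)   ≤⟨ +-mono-≤ Y≤ Z≤ ⟩
  Q + Q                 ∎)
  where
  open ≤-Reasoning
  shuffle : ∀ Y Z G Q → ((Y + Z) + G) + Q ≡ (Y + Z) + (Q + G)
  shuffle = solve-∀
  shuffle′ : ∀ Y Z GY GZ → (Y + Z) + (GY + GZ) ≡ (Y + GY) + (Z + GZ)
  shuffle′ = solve-∀

module LowerBound {n : ℕ} (φ : Formula n) (ro : IsReadOnce φ) (f : BoolFun n) (φ≡f : ∀ a → eval φ a ≡ f a)
                  (g : Partial n → ℕ) (Q : ℕ) (isGoal : IsGoalFunction f g Q) where

  g-monotone : Monotone g
  g-monotone = proj₁ isGoal

  g-submodular : Submodular g
  g-submodular = proj₁ (proj₂ isGoal)

  g≡Q⇔certificate : ∀ b → (g b ≡ Q) ⇔ ContainsCertificate f b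
  g≡Q⇔certificate = proj₂ (proj₂ (proj₂ isGoal))

  const⇒g≡Q : ∀ {b w} → residual φ b ≡ const w → g b ≡ Q
  const⇒g≡Q {b} {w} eq = Equivalence.from (g≡Q⇔certificate b)
    (b , ⪰-refl b , forced⇒certificate w λ a a⪰b → trans (sym (φ≡f a)) (residual-const⇒forced φ eq a a⪰b))

  unforced : ∀ {b d c} → residual φ b ≡ sized d c → ∀ {c'} → b ⪰ c' → ∀ v →
             ¬ (∀ a → total a ⪰ c' → f a ≡ not v)
  unforced {b} eq b⪰c' v forced with realisable φ ro b v (sized≢const (not v) eq)
  ... | a , a⪰b , ev = not-¬ (trans (sym (φ≡f a)) ev) (forced a (⪰-trans a⪰b b⪰c'))

  sized⇒g≢Q : ∀ {b d c} → residual φ b ≡ sized d c → g b ≢ Q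
  sized⇒g≢Q {b} eq gb≡Q with Equivalence.to (g≡Q⇔certificate b) gb≡Q
  ... | _ , b⪰c' , inj₁ forcesFalse = unforced eq b⪰c' true forcesFalse
  ... | _ , b⪰c' , inj₂ forcesTrue = unforced eq b⪰c' false forcesTrue

  Bound : Partial n → Set
  Bound b = sizeProduct (residual φ b) + g b ≤ Q

  bound-const : ∀ {b w} → residual φ b ≡ const w → Bound b
  bound-const {b} {true} eq rewrite eq = ≤-reflexive (const⇒g≡Q eq)
  bound-const {b} {false} eq rewrite eq = ≤-reflexive (const⇒g≡Q eq)

  bound-atomic : ∀ {b} → Atomic (residual φ) (vars φ) b → Bound b
  bound-atomic {b} (eq , i , _ , free , ℓ , w , forced) rewrite eq =
    ≤∧≢⇒< (≤-trans (g-monotone b i ℓ free) (≤-reflexive (const⇒g≡Q forced))) (sized⇒g≢Q eq)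

  residual-extend : ∀ b S → residual φ (extend b S) ≡ residual φ (S ∪ b)
  residual-extend b S = residual-local φ _ _ λ j _ → extend-pointwise b S j

  -- Both pieces of a proper split assign something, so the induction hypothesis applies to them.
  bound-split : ∀ {b v} (s : Split (residual φ) (vars φ) b v) → Proper s →
                (∀ {b'} → freeCount b' < freeCount b → Bound b') → Bound b
  bound-split {b} {v} s (¬L , ¬R) IH =
    split-bound _ (g b) _ _ (g (extend b L)) (g (extend b R)) Q
      (sizeProduct-split v _ _ _ keptL keptR shared) goals (piece L L-fresh L-nonempty) (piece R R-fresh R-nonempty)
    where
    open Split s
    piece : ∀ S → FreeIn S b → ¬ (∀ j → S j ≡ nothing) →
            sizeProduct (residual φ (S ∪ b)) + g (extend b S) ≤ Q
    piece S fresh nonempty with someAssigned S nonempty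
    ... | j , w , Sj = subst (λ x → sizeProduct x + g (extend b S) ≤ Q) (residual-extend b S)
                             (IH (freeCount-extend-< b S fresh Sj))
    L-nonempty : ¬ (∀ j → L j ≡ nothing)
    L-nonempty none =
      ¬R (trans (residual-local φ _ _ λ j _ → cong (_<∣> (R j <∣> b j)) (sym (none j))) forces)
    R-nonempty : ¬ (∀ j → R j ≡ nothing)
    R-nonempty none =
      ¬L (trans (residual-local φ _ _ λ j _ → cong (λ m → L j <∣> (m <∣> b j)) (sym (none j))) forces)
    bR⪰b : extend b R ⪰ b
    bR⪰b j ℓ bj rewrite extend-pointwise b R j with R j in Rj
    ... | just w = contradiction (trans (sym bj) (R-fresh j w Rj)) λ ()
    ... | nothing = bj
    L-fresh′ : FreeIn L (extend b R)
    L-fresh′ j w Lj rewrite extend-pointwise b R j with R j in Rj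
    ... | just w' = contradiction Rj (L#R j w w' Lj)
    ... | nothing = L-fresh j w Lj
    goals : Q + g b ≤ g (extend b L) + g (extend b R)
    goals = subst (λ x → x + g b ≤ g (extend b L) + g (extend b R))
              (const⇒g≡Q (trans (residual-local φ _ _ λ j _ →
                                   trans (extend-pointwise (extend b R) L j) (cong (L j <∣>_) (extend-pointwise b R j)))
                                 forces))
              (submodular-extend g g-submodular L bR⪰b L-fresh L-fresh′)

  bound : ∀ b → Bound b
  bound = WF.All.wfRec (On.wellFounded freeCount <-wellFounded) _ Bound step
    where
    step : ∀ b → (∀ {b'} → freeCount b' < freeCount b → Bound b') → Bound b
    step b IH with shape (residual φ b)
    ... | isConst w eq = bound-const eq
    ... | nonConst ≢t ≢f with properlySplittable φ ro b ≢t ≢f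
    ...   | inj₁ (s , proper) = bound-split s proper IH
    ...   | inj₂ (inj₁ (s , proper)) = bound-split s proper IH
    ...   | inj₂ (inj₂ atomic) = bound-atomic atomic

theorem4 : ∀ (n : ℕ) (f : BoolFun n) → ReadOnceFunction f →
    ∀ (d c : ℕ) → IsDS f d → IsCS f c → IsGamma f (d * c)
theorem4 n f (φ , ro , φ≡f) d c ((ts , ts-dnf , |ts|≡d) , ds-min) ((cs , cs-cnf , |cs|≡c) , cs-min) =
  (goal , subst₂ (λ x y → IsGoalFunction f goal (x * y)) |ts|≡d |cs|≡c isGoalFunction) , lower
  where
  open ProductGoal f ts cs ts-dnf cs-cnf using (goal; isGoalFunction)
  lower : ∀ g Q → IsGoalFunction f g Q → d * c ≤ Q
  lower g Q isGoal = begin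
    d * c                                      ≤⟨ *-mono-≤ (ds-min (dnf φ) (dnf-computes φ φ≡f))
                                                           (cs-min (cnf φ) (cnf-computes φ φ≡f)) ⟩
    length (dnf φ) * length (cnf φ)            ≡⟨ cong sizeProduct (residual-unassigned φ) ⟨
    sizeProduct (residual φ unassigned)        ≤⟨ m≤m+n _ (g unassigned) ⟩
    sizeProduct (residual φ unassigned) + g unassigned ≤⟨ LowerBound.bound φ ro f φ≡f g Q isGoal unassigned ⟩
    Q                                          ∎
    where open ≤-Reasoning
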